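{- For any integer $n\ge0$ and any prime number $p$, there is an abelian group of order $p^{\lfloor n(1+\log(n))\rfloor}$ containing a subgroup isomorphic to every abelian $p$-group of order $\le p^n$.
   Context: $\log$ is the natural logarithm, and $0\log(0)$ is interpreted as $0$. -}

module Defs where

open import Level using (Level; _⊔_)
open import Data.Nat using (ℕ; zero; suc; _+_; _*_; _∸_; _^_; _≤_; _!)

open import Data.Fin using (Fin)
open import Data.Product using (Σ; _×_)
open import Data.Sum using (_⊎_)
open import Relation.Nullary using (¬_)
open import Relation.Binary.PropositionalEquality using (setoid)
open import Algebra.Bundles using (AbelianGroup)
open import Function.Bundles using (Inverse)
open import Algebra.Morphism.Structures using (module GroupMorphisms)

-- expScaled k j = j! * Σ_{i=0}^{j} k^i / i!   (a natural number)
expScaled : ℕ → ℕ → ℕ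
expScaled k zero    = 1
expScaled k (suc j) = suc j * expScaled k j + k ^ suc j

-- e^k ≤ N  (for naturals k, N): every Taylor partial sum of e^k is ≤ N,
-- i.e. Σ_{i≤j} k^i/i! ≤ N for all j (the partial sums increase to e^k).
ExpLe : ℕ → ℕ → Set
ExpLe k N = ∀ j → expScaled k j ≤ N * j !

-- LeNLog n m  ⇔  (m : ℝ) ≤ n (1 + log n)   (with 0 log 0 = 0).
-- For n ≥ 1:  m ≤ n + n log n  ⇔  m ≤ n  or  e^(m-n) ≤ n^n.
-- For n = 0 (0^0 = 1): the condition reduces to m ≤ 0, matching n(1+log n) = 0.
LeNLog : ℕ → ℕ → Set
LeNLog n m = m ≤ n ⊎ ExpLe (m ∸ n) (n ^ n)

IsFloorNLog : ℕ → ℕ → Set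
IsFloorNLog n m = LeNLog n m × ¬ LeNLog n (suc m)

HasOrder : ∀ {c ℓ} → AbelianGroup c ℓ → ℕ → Set (c ⊔ ℓ)
HasOrder G m = Inverse (AbelianGroup.setoid G) (setoid (Fin m))

EmbedsInto : ∀ {c₁ ℓ₁ c₂ ℓ₂} → AbelianGroup c₁ ℓ₁ → AbelianGroup c₂ ℓ₂ → Set (c₁ ⊔ ℓ₁ ⊔ c₂ ⊔ ℓ₂)
EmbedsInto H G =
  Σ (AbelianGroup.Carrier H → AbelianGroup.Carrier G) λ f →
    GroupMorphisms.IsGroupMonomorphism (AbelianGroup.rawGroup H) (AbelianGroup.rawGroup G) f

{-# OPTIONS --safe #-}
module Submission where

-- An abelian group of order p^k is ⊕ᵢ ℤ/p^aᵢ with a₁ ≥ a₂ ≥ … ≥ 1 and Σ aᵢ = k; this is proved by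
-- splitting off the cyclic subgroup generated by an element of maximal order and recursing on the
-- quotient. If k ≤ n then i·aᵢ ≤ a₁ + … + aᵢ ≤ n, so aᵢ ≤ ⌊n/i⌋, and all these groups embed into
-- ℤ/p^⌊n/1⌋ ⊕ … ⊕ ℤ/p^⌊n/n⌋ ⊕ ℤ/p^r, the last factor padding the order to p^m. This requires
-- Σ_{i≤n} ⌊n/i⌋ ≤ n (1 + log n), i.e. e^(⌊n/2⌋ + … + ⌊n/n⌋) ≤ n^n. Comparing the exponential series with
-- the geometric one gives e^(1/(i+1)) ≤ (i+1)/i, hence e^⌊n/(i+1)⌋ ≤ ((i+1)/i)^n, and these bounds
-- telescope to n^n. Exponentials are handled through their Taylor partial sums, for which
-- e^(x+y) ≤ e^x e^y follows from the binomial theorem.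

open import Defs
open import Level using (Level)
open import Data.Nat using (ℕ; suc; _+_; _∸_; _^_; _≤_; NonZero)
import Data.Nat.Properties as ℕ
open import Data.Nat.DivMod using (_/_)
open import Data.Nat.Primality using (Prime; prime⇒nonZero)
open import Data.Nat.ListAction using (sum)
open import Data.Nat.ListAction.Properties using (sum-++)
open import Data.List.Base using (List; []; _∷_; _++_)
open import Data.Product using (Σ; _×_; _,_)
open import Function.Base using (_∘_)
import Relation.Binary.PropositionalEquality as ≡
open import Algebra.Bundles using (AbelianGroup)

module FiniteSums where

  open import Data.Nat
  open import Data.Nat.Properties
  open import Data.Nat.Combinatorics using (_C_)
  open import Data.List.Base using (applyUpTo)
  open import Data.Fin.Base using (toℕ)
  open import Relation.Binary.PropositionalEquality
  import Algebra.Definitions.RawSemiring +-*-rawSemiring as Raw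
  import Algebra.Properties.CommutativeSemiring.Binomial +-*-commutativeSemiring as Binomial
  import Algebra.Properties.CommutativeSemiring.Exp +-*-commutativeSemiring as Exp
  import Algebra.Properties.Monoid.Sum +-0-monoid as FinSum
  import Algebra.Properties.CommutativeSemigroup +-commutativeSemigroup as +-CS

  ∑< : ℕ → (ℕ → ℕ) → ℕ
  ∑< n f = sum (applyUpTo f n)

  ∑<-cong : ∀ n {f g : ℕ → ℕ} → (∀ {u} → u < n → f u ≡ g u) → ∑< n f ≡ ∑< n g
  ∑<-cong zero    f≡g = refl
  ∑<-cong (suc n) f≡g = cong₂ _+_ (f≡g z<s) (∑<-cong n (f≡g ∘ s<s))

  ∑<-mono-≤ : ∀ n {f g : ℕ → ℕ} → (∀ {u} → u < n → f u ≤ g u) → ∑< n f ≤ ∑< n g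
  ∑<-mono-≤ zero    f≤g = z≤n
  ∑<-mono-≤ (suc n) f≤g = +-mono-≤ (f≤g z<s) (∑<-mono-≤ n (f≤g ∘ s<s))

  ∑<-distrib-+ : ∀ n (f g : ℕ → ℕ) → ∑< n (λ u → f u + g u) ≡ ∑< n f + ∑< n g
  ∑<-distrib-+ zero    f g = refl
  ∑<-distrib-+ (suc n) f g = begin
    (f 0 + g 0) + ∑< n (λ u → f (suc u) + g (suc u))   ≡⟨ cong ((f 0 + g 0) +_) (∑<-distrib-+ n (f ∘ suc) (g ∘ suc)) ⟩
    (f 0 + g 0) + (∑< n (f ∘ suc) + ∑< n (g ∘ suc))   ≡⟨ +-CS.interchange (f 0) (g 0) _ _ ⟩
    ∑< (suc n) f + ∑< (suc n) g                         ∎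
    where open ≡-Reasoning

  ∑<-distribˡ : ∀ n k (f : ℕ → ℕ) → k * ∑< n f ≡ ∑< n (λ u → k * f u)
  ∑<-distribˡ zero    k f = *-zeroʳ k
  ∑<-distribˡ (suc n) k f = trans (*-distribˡ-+ k (f 0) _) (cong (k * f 0 +_) (∑<-distribˡ n k (f ∘ suc)))

  ∑<-last : ∀ n (f : ℕ → ℕ) → ∑< (suc n) f ≡ ∑< n f + f n
  ∑<-last zero    f = +-identityʳ (f 0)
  ∑<-last (suc n) f = trans (cong (f 0 +_) (∑<-last n (f ∘ suc))) (sym (+-assoc (f 0) _ _))

  ∑-toℕ≡∑< : ∀ n (f : ℕ → ℕ) → FinSum.sum {n} (f ∘ toℕ) ≡ ∑< n f
  ∑-toℕ≡∑< zero    f = refl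
  ∑-toℕ≡∑< (suc n) f = cong (f 0 +_) (∑-toℕ≡∑< n (f ∘ suc))

  ×≡* : ∀ m n → m Raw.× n ≡ m * n
  ×≡* zero    n = refl
  ×≡* (suc m) n = cong (n +_) (×≡* m n)

  ^≡^ : ∀ m n → m Raw.^ n ≡ m ^ n
  ^≡^ m zero    = refl
  ^≡^ m (suc n) = cong (m *_) (^≡^ m n)

  binomial-theorem : ∀ a c n → (a + c) ^ n ≡ ∑< (suc n) (λ u → (n C u) * (a ^ u * c ^ (n ∸ u)))
  binomial-theorem a c n = begin
    (a + c) ^ n                             ≡⟨ ^≡^ (a + c) n ⟨
    (a + c) Raw.^ n                         ≡⟨ Binomial.theorem n a c ⟩
    Binomial.binomialExpansion a c n        ≡⟨ FinSum.sum-cong-≗ {suc n} (λ u → term (toℕ u)) ⟩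
    FinSum.sum {suc n} (binomialTerm ∘ toℕ) ≡⟨ ∑-toℕ≡∑< (suc n) binomialTerm ⟩
    ∑< (suc n) binomialTerm                 ∎
    where
    open ≡-Reasoning
    binomialTerm : ℕ → ℕ
    binomialTerm u = (n C u) * (a ^ u * c ^ (n ∸ u))
    term : ∀ u → (n C u) Raw.× (a Raw.^ u * c Raw.^ (n ∸ u)) ≡ (n C u) * (a ^ u * c ^ (n ∸ u))
    term u = trans (×≡* (n C u) _) (cong ((n C u) *_) (cong₂ _*_ (^≡^ a u) (^≡^ c (n ∸ u))))

  [m*n]^o≡m^o*n^o : ∀ m n o → (m * n) ^ o ≡ m ^ o * n ^ o
  [m*n]^o≡m^o*n^o m n o = begin
    (m * n) ^ o             ≡⟨ ^≡^ (m * n) o ⟨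
    (m * n) Raw.^ o         ≡⟨ Exp.^-distrib-* m n o ⟩
    m Raw.^ o * n Raw.^ o   ≡⟨ cong₂ _*_ (^≡^ m o) (^≡^ n o) ⟩
    m ^ o * n ^ o           ∎
    where open ≡-Reasoning

module ExponentialBound where

  open import Data.Nat
  open import Data.Nat.Properties
  open import Data.Nat.DivMod using (m/n*n≡m; n/1≡n; m/n*n≤m)
  open import Data.Nat.Combinatorics using (_C_; nCk≡n!/k![n-k]!; k![n∸k]!∣n!; nCn≡1)
  open import Data.Nat.Tactic.RingSolver using (solve-∀)
  open import Data.Sum using (inj₁; inj₂)
  open import Data.List.Base using (applyUpTo)
  open import Relation.Binary.PropositionalEquality
  open import Relation.Nullary using (contradiction; yes; no)
  open import Algebra.Properties.CommutativeSemigroup *-commutativeSemigroup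
    using (x∙yz≈y∙xz; x∙yz≈xz∙y; x∙yz≈yx∙z; xy∙z≈xz∙y; interchange)
  open FiniteSums

  nCk*[k!*[n∸k]!]≡n! : ∀ {n k} → k ≤ n → (n C k) * (k ! * (n ∸ k) !) ≡ n !
  nCk*[k!*[n∸k]!]≡n! {n} {k} k≤n = begin
    (n C k) * (k ! * (n ∸ k) !)                 ≡⟨ cong (_* (k ! * (n ∸ k) !)) (nCk≡n!/k![n-k]! k≤n) ⟩
    n ! / (k ! * (n ∸ k) !) * (k ! * (n ∸ k) !) ≡⟨ m/n*n≡m (k![n∸k]!∣n! k≤n) ⟩
    n !                                         ∎
    where
    open ≡-Reasoning
    instance _ = k !* (n ∸ k) !≢0

  [1+j∸u]*[1+j]Cu≡[1+j]*jCu : ∀ {j u} → u ≤ j → (suc j ∸ u) * (suc j C u) ≡ suc j * (j C u)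
  [1+j∸u]*[1+j]Cu≡[1+j]*jCu {j} {u} u≤j = *-cancelʳ-≡ _ _ (u ! * (j ∸ u) !) {{u !* (j ∸ u) !≢0}} (begin
    (suc j ∸ u) * (suc j C u) * (u ! * (j ∸ u) !)   ≡⟨ regroup (suc j ∸ u) (suc j C u) (u !) ((j ∸ u) !) ⟩
    (suc j C u) * (u ! * ((suc j ∸ u) * (j ∸ u) !))
      ≡⟨ cong (λ v → (suc j C u) * (u ! * (v * (j ∸ u) !))) (+-∸-assoc 1 u≤j) ⟩
    (suc j C u) * (u ! * (suc (j ∸ u)) !)          ≡⟨ cong (λ v → (suc j C u) * (u ! * v !)) (+-∸-assoc 1 u≤j) ⟨
    (suc j C u) * (u ! * (suc j ∸ u) !)            ≡⟨ nCk*[k!*[n∸k]!]≡n! (m≤n⇒m≤1+n u≤j) ⟩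
    suc j * j !                                    ≡⟨ cong (suc j *_) (nCk*[k!*[n∸k]!]≡n! u≤j) ⟨
    suc j * ((j C u) * (u ! * (j ∸ u) !))          ≡⟨ *-assoc (suc j) (j C u) _ ⟨
    suc j * (j C u) * (u ! * (j ∸ u) !)            ∎)
    where
    open ≡-Reasoning
    regroup : ∀ x c f g → x * c * (f * g) ≡ c * (f * (x * g))
    regroup = solve-∀

  -- expSum a b j = j! b^j Σ_{i≤j} (a/b)^i / i!, a scaled Taylor partial sum of e^(a/b).
  expSum : ℕ → ℕ → ℕ → ℕ
  expSum a b zero    = 1
  expSum a b (suc j) = suc j * b * expSum a b j + a ^ suc j

  expScaled≡expSum : ∀ a j → expScaled a j ≡ expSum a 1 j
  expScaled≡expSum a zero    = refl
  expScaled≡expSum a (suc j) = cong₂ (λ x y → x * y + a ^ suc j) (sym (*-identityʳ (suc j))) (expScaled≡expSum a j)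

  last-term : ∀ n a (f : ℕ → ℕ) → f 0 ≡ 1 → (n C n) * (a ^ n * f (n ∸ n)) ≡ a ^ n
  last-term n a f f0≡1 = begin
    (n C n) * (a ^ n * f (n ∸ n)) ≡⟨ cong₂ (λ x y → x * (a ^ n * f y)) (nCn≡1 n) (n∸n≡0 n) ⟩
    1 * (a ^ n * f 0)             ≡⟨ *-identityˡ _ ⟩
    a ^ n * f 0                   ≡⟨ cong (a ^ n *_) f0≡1 ⟩
    a ^ n * 1                     ≡⟨ *-identityʳ _ ⟩
    a ^ n                         ∎
    where open ≡-Reasoning

  taylor-term-suc : ∀ a c b {j u} → u ≤ j →
    suc j * b * ((j C u) * (a ^ u * expSum c b (j ∸ u))) + (suc j C u) * (a ^ u * c ^ (suc j ∸ u)) ≡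
    (suc j C u) * (a ^ u * expSum c b (suc j ∸ u))
  taylor-term-suc a c b {j} {u} u≤j = begin
    suc j * b * ((j C u) * (a ^ u * E)) + C′ * (a ^ u * c ^ (suc j ∸ u))
      ≡⟨ cong (λ v → suc j * b * ((j C u) * (a ^ u * E)) + C′ * (a ^ u * c ^ v)) 1+j∸u≡1+r ⟩
    suc j * b * ((j C u) * (a ^ u * E)) + C′ * (a ^ u * c ^ suc r)
      ≡⟨ cong (_+ C′ * (a ^ u * c ^ suc r)) (regroup (suc j) b (j C u) (a ^ u * E)) ⟩
    suc j * (j C u) * (b * (a ^ u * E)) + C′ * (a ^ u * c ^ suc r)
      ≡⟨ cong (λ v → v * (b * (a ^ u * E)) + C′ * (a ^ u * c ^ suc r)) absorption ⟨
    suc r * C′ * (b * (a ^ u * E)) + C′ * (a ^ u * c ^ suc r)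
      ≡⟨ factor (suc r) C′ b (a ^ u) E (c ^ suc r) ⟩
    C′ * (a ^ u * expSum c b (suc r))
      ≡⟨ cong (λ v → C′ * (a ^ u * expSum c b v)) 1+j∸u≡1+r ⟨
    C′ * (a ^ u * expSum c b (suc j ∸ u)) ∎
    where
    open ≡-Reasoning
    r  = j ∸ u
    E  = expSum c b r
    C′ = suc j C u
    1+j∸u≡1+r : suc j ∸ u ≡ suc r
    1+j∸u≡1+r = +-∸-assoc 1 u≤j
    absorption : suc r * C′ ≡ suc j * (j C u)
    absorption = trans (cong (_* C′) (sym 1+j∸u≡1+r)) ([1+j∸u]*[1+j]Cu≡[1+j]*jCu u≤j)
    regroup : ∀ s b x y → s * b * (x * y) ≡ s * x * (b * y)
    regroup = solve-∀
    factor : ∀ s x b y e w → s * x * (b * (y * e)) + x * (y * w) ≡ x * (y * (s * b * e + w))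
    factor = solve-∀

  expSum-taylor : ∀ a c b j → expSum (a + c) b j ≡ ∑< (suc j) (λ u → (j C u) * (a ^ u * expSum c b (j ∸ u)))
  expSum-taylor a c b zero    = refl
  expSum-taylor a c b (suc j) = begin
    suc j * b * expSum (a + c) b j + (a + c) ^ suc j
      ≡⟨ cong₂ (λ x y → suc j * b * x + y) (expSum-taylor a c b j) (binomial-theorem a c (suc j)) ⟩
    suc j * b * ∑< (suc j) term + ∑< (suc (suc j)) binomialTerm
      ≡⟨ cong₂ _+_ (∑<-distribˡ (suc j) (suc j * b) term) (∑<-last (suc j) binomialTerm) ⟩
    ∑< (suc j) scaledTerm + (∑< (suc j) binomialTerm + binomialTerm (suc j))
      ≡⟨ +-assoc (∑< (suc j) scaledTerm) _ _ ⟨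
    ∑< (suc j) scaledTerm + ∑< (suc j) binomialTerm + binomialTerm (suc j)
      ≡⟨ cong₂ _+_ (∑<-distrib-+ (suc j) scaledTerm binomialTerm)
                   (trans (last-term (suc j) a (expSum c b) refl) (sym (last-term (suc j) a (c ^_) refl))) ⟨
    ∑< (suc j) (λ u → scaledTerm u + binomialTerm u) + term′ (suc j)
      ≡⟨ cong (_+ term′ (suc j)) (∑<-cong (suc j) λ {u} u<1+j → taylor-term-suc a c b (≤-pred u<1+j)) ⟩
    ∑< (suc j) term′ + term′ (suc j)
      ≡⟨ ∑<-last (suc j) term′ ⟨
    ∑< (suc (suc j)) term′ ∎
    where
    open ≡-Reasoning
    term scaledTerm term′ binomialTerm : ℕ → ℕ
    term u         = (j C u) * (a ^ u * expSum c b (j ∸ u))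
    scaledTerm u   = suc j * b * term u
    term′ u        = (suc j C u) * (a ^ u * expSum c b (suc j ∸ u))
    binomialTerm u = (suc j C u) * (a ^ u * c ^ (suc j ∸ u))

  expSum-0 : ∀ b m → expSum 0 b m ≡ b ^ m * m !
  expSum-0 b zero    = refl
  expSum-0 b (suc m) = begin
    suc m * b * expSum 0 b m + 0 ^ suc m ≡⟨ cong₂ (λ x y → suc m * b * x + y) (expSum-0 b m) (*-zeroˡ (0 ^ m)) ⟩
    suc m * b * (b ^ m * m !) + 0        ≡⟨ regroup (suc m) b (b ^ m) (m !) ⟩
    b * b ^ m * (suc m * m !)            ∎
    where
    open ≡-Reasoning
    regroup : ∀ s b x y → s * b * (x * y) + 0 ≡ b * x * (s * y)
    regroup = solve-∀

  expSum-expand : ∀ a b j → expSum a b j ≡ ∑< (suc j) (λ u → (j C u) * (a ^ u * (b ^ (j ∸ u) * (j ∸ u) !)))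
  expSum-expand a b j = begin
    expSum a b j       ≡⟨ cong (λ x → expSum x b j) (+-identityʳ a) ⟨
    expSum (a + 0) b j ≡⟨ expSum-taylor a 0 b j ⟩
    ∑< (suc j) (λ u → (j C u) * (a ^ u * expSum 0 b (j ∸ u)))
      ≡⟨ ∑<-cong (suc j) (λ {u} _ → cong (λ x → (j C u) * (a ^ u * x)) (expSum-0 b (j ∸ u))) ⟩
    ∑< (suc j) (λ u → (j C u) * (a ^ u * (b ^ (j ∸ u) * (j ∸ u) !))) ∎
    where open ≡-Reasoning

  expSum-ratio-mono : ∀ c b m u → b ^ (u + m) * (u + m) ! * expSum c b m ≤ b ^ m * m ! * expSum c b (u + m)
  expSum-ratio-mono c b m zero    = ≤-refl
  expSum-ratio-mono c b m (suc u) = begin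
    b * b ^ (u + m) * (suc (u + m) * (u + m) !) * expSum c b m ≡⟨ regroup b (b ^ (u + m)) (suc (u + m)) ((u + m) !) (expSum c b m) ⟩
    suc (u + m) * b * (b ^ (u + m) * (u + m) ! * expSum c b m) ≤⟨ *-monoʳ-≤ (suc (u + m) * b) (expSum-ratio-mono c b m u) ⟩
    suc (u + m) * b * (b ^ m * m ! * expSum c b (u + m))      ≡⟨ x∙yz≈y∙xz (suc (u + m) * b) (b ^ m * m !) _ ⟩
    b ^ m * m ! * (suc (u + m) * b * expSum c b (u + m))      ≤⟨ *-monoʳ-≤ (b ^ m * m !) (m≤m+n _ _) ⟩
    b ^ m * m ! * expSum c b (suc u + m)                      ∎
    where
    open ≤-Reasoning
    regroup : ∀ b x s y e → b * x * (s * y) * e ≡ s * b * (x * y * e)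
    regroup = solve-∀

  expSum-+ : ∀ a c b j → b ^ j * j ! * expSum (a + c) b j ≤ expSum a b j * expSum c b j
  expSum-+ a c b j = begin
    W * expSum (a + c) b j                        ≡⟨ cong (W *_) (expSum-taylor a c b j) ⟩
    W * ∑< (suc j) taylorTerm                     ≡⟨ ∑<-distribˡ (suc j) W taylorTerm ⟩
    ∑< (suc j) (λ u → W * taylorTerm u)           ≤⟨ ∑<-mono-≤ (suc j) termwise ⟩
    ∑< (suc j) (λ u → expSum c b j * expandTerm u) ≡⟨ ∑<-distribˡ (suc j) (expSum c b j) expandTerm ⟨
    expSum c b j * ∑< (suc j) expandTerm          ≡⟨ cong (expSum c b j *_) (expSum-expand a b j) ⟨
    expSum c b j * expSum a b j                   ≡⟨ *-comm (expSum c b j) (expSum a b j) ⟩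
    expSum a b j * expSum c b j                   ∎
    where
    open ≤-Reasoning
    W = b ^ j * j !
    taylorTerm expandTerm : ℕ → ℕ
    taylorTerm u = (j C u) * (a ^ u * expSum c b (j ∸ u))
    expandTerm u = (j C u) * (a ^ u * (b ^ (j ∸ u) * (j ∸ u) !))
    termwise : ∀ {u} → u < suc j → W * taylorTerm u ≤ expSum c b j * expandTerm u
    termwise {u} (s≤s u≤j) = begin
      W * ((j C u) * (a ^ u * E r))           ≡⟨ regroup W (j C u) (a ^ u) (E r) ⟩
      κ * (b ^ j * j ! * E r)                 ≡⟨ cong (λ v → κ * (b ^ v * v ! * E r)) u+r≡j ⟨
      κ * (b ^ (u + r) * (u + r) ! * E r)     ≤⟨ *-monoʳ-≤ κ (expSum-ratio-mono c b r u) ⟩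
      κ * (b ^ r * r ! * E (u + r))           ≡⟨ cong (λ v → κ * (b ^ r * r ! * E v)) u+r≡j ⟩
      κ * (b ^ r * r ! * E j)                 ≡⟨ regroup′ (j C u) (a ^ u) (b ^ r * r !) (E j) ⟩
      E j * ((j C u) * (a ^ u * (b ^ r * r !))) ∎
      where
      E = expSum c b
      r = j ∸ u
      κ = (j C u) * a ^ u
      u+r≡j : u + r ≡ j
      u+r≡j = m+[n∸m]≡n u≤j
      regroup : ∀ w x y e → w * (x * (y * e)) ≡ x * y * (w * e)
      regroup = solve-∀
      regroup′ : ∀ x y z e → x * y * (z * e) ≡ e * (x * (y * z))
      regroup′ = solve-∀

  -- ExpFracLe a b A B encodes e^(a/b) ≤ A/B.
  record ExpFracLe (a b A B : ℕ) : Set where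
    constructor expFracLe
    field partialSum≤ : ∀ j → B * expSum a b j ≤ A * (b ^ j * j !)
  open ExpFracLe

  ExpFracLe-* : ∀ {a c b A B D E} .{{_ : NonZero b}} →
    ExpFracLe a b A B → ExpFracLe c b D E → ExpFracLe (a + c) b (A * D) (B * E)
  ExpFracLe-* {a} {c} {b} {A} {B} {D} {E} ab≤AB cb≤DE = expFracLe λ j →
    *-cancelʳ-≤ _ _ (W j) {{m*n≢0 (b ^ j) (j !) {{m^n≢0 b j}} {{j !≢0}}}} (begin
    B * E * expSum (a + c) b j * W j        ≡⟨ x∙yz≈xz∙y (B * E) (W j) (expSum (a + c) b j) ⟨
    B * E * (W j * expSum (a + c) b j)      ≤⟨ *-monoʳ-≤ (B * E) (expSum-+ a c b j) ⟩
    B * E * (expSum a b j * expSum c b j)   ≡⟨ interchange B E (expSum a b j) (expSum c b j) ⟩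
    (B * expSum a b j) * (E * expSum c b j) ≤⟨ *-mono-≤ (partialSum≤ ab≤AB j) (partialSum≤ cb≤DE j) ⟩
    (A * W j) * (D * W j)                   ≡⟨ interchange A (W j) D (W j) ⟩
    A * D * (W j * W j)                     ≡⟨ *-assoc (A * D) (W j) (W j) ⟨
    A * D * W j * W j                       ∎)
    where
    open ≤-Reasoning
    W : ℕ → ℕ
    W j = b ^ j * j !

  ExpFracLe-weaken : ∀ {a b A B A′ B′} .{{_ : NonZero B}} → ExpFracLe a b A B → A * B′ ≤ A′ * B → ExpFracLe a b A′ B′
  ExpFracLe-weaken {a} {b} {A} {B} {A′} {B′} ab≤AB AB′≤A′B = expFracLe λ j → *-cancelʳ-≤ _ _ B (begin
    B′ * expSum a b j * B   ≡⟨ x∙yz≈xz∙y B′ B (expSum a b j) ⟨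
    B′ * (B * expSum a b j) ≤⟨ *-monoʳ-≤ B′ (partialSum≤ ab≤AB j) ⟩
    B′ * (A * W j)            ≡⟨ x∙yz≈yx∙z B′ A (W j) ⟩
    A * B′ * W j              ≤⟨ *-monoˡ-≤ (W j) AB′≤A′B ⟩
    A′ * B * W j              ≡⟨ xy∙z≈xz∙y A′ B (W j) ⟩
    A′ * W j * B              ∎)
    where
    open ≤-Reasoning
    W : ℕ → ℕ
    W j = b ^ j * j !

  expSum-scale : ∀ k a b j → expSum (k * a) (k * b) j ≡ k ^ j * expSum a b j
  expSum-scale k a b zero    = refl
  expSum-scale k a b (suc j) = begin
    suc j * (k * b) * expSum (k * a) (k * b) j + (k * a) ^ suc j
      ≡⟨ cong₂ (λ x y → suc j * (k * b) * x + y) (expSum-scale k a b j) ([m*n]^o≡m^o*n^o k a (suc j)) ⟩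
    suc j * (k * b) * (k ^ j * expSum a b j) + k ^ suc j * a ^ suc j
      ≡⟨ factor (suc j) k b (k ^ j) (expSum a b j) (a ^ suc j) ⟩
    k * k ^ j * (suc j * b * expSum a b j + a ^ suc j) ∎
    where
    open ≡-Reasoning
    factor : ∀ s k b x e y → s * (k * b) * (x * e) + k * x * y ≡ k * x * (s * b * e + y)
    factor = solve-∀

  ExpFracLe-unscale : ∀ {k a b A B} .{{_ : NonZero k}} → ExpFracLe (k * a) (k * b) A B → ExpFracLe a b A B
  ExpFracLe-unscale {k} {a} {b} {A} {B} scaled = expFracLe λ j → *-cancelˡ-≤ (k ^ j) {{m^n≢0 k j}} (begin
    k ^ j * (B * expSum a b j)    ≡⟨ x∙yz≈y∙xz (k ^ j) B (expSum a b j) ⟩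
    B * (k ^ j * expSum a b j)    ≡⟨ cong (B *_) (expSum-scale k a b j) ⟨
    B * expSum (k * a) (k * b) j  ≤⟨ partialSum≤ scaled j ⟩
    A * ((k * b) ^ j * j !)       ≡⟨ cong (λ x → A * (x * j !)) ([m*n]^o≡m^o*n^o k b j) ⟩
    A * (k ^ j * b ^ j * j !)     ≡⟨ cong (A *_) (*-assoc (k ^ j) (b ^ j) (j !)) ⟩
    A * (k ^ j * (b ^ j * j !))   ≡⟨ x∙yz≈y∙xz A (k ^ j) (b ^ j * j !) ⟩
    k ^ j * (A * (b ^ j * j !))   ∎)
    where
    open ≤-Reasoning

  ExpFracLe-0 : ∀ b → ExpFracLe 0 b 1 1
  ExpFracLe-0 b = expFracLe λ j → ≤-reflexive (trans (*-identityˡ _) (trans (expSum-0 b j) (sym (*-identityˡ _))))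

  ExpFracLe-^ : ∀ {a b A B} .{{_ : NonZero b}} → ExpFracLe a b A B → ∀ t → ExpFracLe (t * a) b (A ^ t) (B ^ t)
  ExpFracLe-^ {b = b} ab≤AB zero    = ExpFracLe-0 b
  ExpFracLe-^         ab≤AB (suc t) = ExpFracLe-* ab≤AB (ExpFracLe-^ ab≤AB t)

  -- The +1 strengthens the induction; the bound is Σ xⁱ/i! ≤ Σ xⁱ = 1/(1-x) for x = 1/(1+m).
  geometric-bound : ∀ m j → m * expSum 1 (suc m) j + 1 ≤ suc m ^ suc j * j !
  geometric-bound m zero    = ≤-reflexive (base m)
    where
    base : ∀ m → m * 1 + 1 ≡ (1 + m) * 1 * 1
    base = solve-∀
  geometric-bound m (suc j) = begin
    m * (suc j * suc m * E + 1 ^ suc j) + 1  ≡⟨ cong (λ x → m * (suc j * suc m * E + x) + 1) (^-zeroˡ (suc j)) ⟩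
    m * (suc j * suc m * E + 1) + 1          ≡⟨ regroup m j E ⟩
    suc j * suc m * (m * E) + suc m          ≤⟨ +-monoʳ-≤ (suc j * suc m * (m * E)) (m≤n*m (suc m) (suc j)) ⟩
    suc j * suc m * (m * E) + suc j * suc m  ≡⟨ cong (suc j * suc m * (m * E) +_) (*-identityʳ (suc j * suc m)) ⟨
    suc j * suc m * (m * E) + suc j * suc m * 1 ≡⟨ *-distribˡ-+ (suc j * suc m) (m * E) 1 ⟨
    suc j * suc m * (m * E + 1)              ≤⟨ *-monoʳ-≤ (suc j * suc m) (geometric-bound m j) ⟩
    suc j * suc m * (suc m ^ suc j * j !)    ≡⟨ regroup′ (suc j) (suc m) (suc m ^ suc j) (j !) ⟩
    suc m ^ suc (suc j) * suc j !            ∎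
    where
    open ≤-Reasoning
    E = expSum 1 (suc m) j
    regroup : ∀ m j e → m * ((1 + j) * (1 + m) * e + 1) + 1 ≡ (1 + j) * (1 + m) * (m * e) + (1 + m)
    regroup = solve-∀
    regroup′ : ∀ s t x f → s * t * (x * f) ≡ t * x * (s * f)
    regroup′ = solve-∀

  e^[1/[1+m]]≤[1+m]/m : ∀ m → ExpFracLe 1 (suc m) (suc m) m
  e^[1/[1+m]]≤[1+m]/m m = expFracLe λ j → begin
    m * expSum 1 (suc m) j     ≤⟨ m≤m+n _ 1 ⟩
    m * expSum 1 (suc m) j + 1 ≤⟨ geometric-bound m j ⟩
    suc m ^ suc j * j !        ≡⟨ *-assoc (suc m) (suc m ^ j) (j !) ⟩
    suc m * (suc m ^ j * j !)  ∎
    where open ≤-Reasoning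

  e≤[1+m]^[1+m]/m^[1+m] : ∀ m .{{_ : NonZero m}} → ExpFracLe 1 1 (suc m ^ suc m) (m ^ suc m)
  e≤[1+m]^[1+m]/m^[1+m] m = ExpFracLe-unscale {k = suc m}
    (subst (λ b → ExpFracLe (suc m * 1) b (suc m ^ suc m) (m ^ suc m)) (sym (*-identityʳ (suc m)))
      (ExpFracLe-^ (e^[1/[1+m]]≤[1+m]/m m) (suc m)))

  b^e*a^n≤b^n*a^e : ∀ {a b e n} → a ≤ b → e ≤ n → b ^ e * a ^ n ≤ b ^ n * a ^ e
  b^e*a^n≤b^n*a^e {a} {b} {e} {n} a≤b e≤n = begin
    b ^ e * a ^ n               ≡⟨ cong (λ k → b ^ e * a ^ k) (m+[n∸m]≡n e≤n) ⟨
    b ^ e * a ^ (e + r)         ≡⟨ cong (b ^ e *_) (^-distribˡ-+-* a e r) ⟩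
    b ^ e * (a ^ e * a ^ r)     ≤⟨ *-monoʳ-≤ (b ^ e) (*-monoʳ-≤ (a ^ e) (^-monoˡ-≤ r a≤b)) ⟩
    b ^ e * (a ^ e * b ^ r)     ≡⟨ x∙yz≈xz∙y (b ^ e) (a ^ e) (b ^ r) ⟩
    b ^ e * b ^ r * a ^ e       ≡⟨ cong (_* a ^ e) (^-distribˡ-+-* b e r) ⟨
    b ^ (e + r) * a ^ e         ≡⟨ cong (λ k → b ^ k * a ^ e) (m+[n∸m]≡n e≤n) ⟩
    b ^ n * a ^ e               ∎
    where
    open ≤-Reasoning
    r = n ∸ e

  e^⌊n/[1+m]⌋≤[1+m]^n/m^n : ∀ m n .{{_ : NonZero m}} → ExpFracLe (n / suc m) 1 (suc m ^ n) (m ^ n)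
  e^⌊n/[1+m]⌋≤[1+m]^n/m^n m n = ExpFracLe-weaken {{m^n≢0 (m ^ suc m) q {{m^n≢0 m (suc m)}}}}
    (subst (λ a → ExpFracLe a 1 ((suc m ^ suc m) ^ q) ((m ^ suc m) ^ q)) (*-identityʳ q) (ExpFracLe-^ (e≤[1+m]^[1+m]/m^[1+m] m) q))
    (begin
      (suc m ^ suc m) ^ q * m ^ n  ≡⟨ cong (_* m ^ n) (^-*-assoc (suc m) (suc m) q) ⟩
      suc m ^ (suc m * q) * m ^ n  ≤⟨ b^e*a^n≤b^n*a^e (n≤1+n m) [1+m]*q≤n ⟩
      suc m ^ n * m ^ (suc m * q)  ≡⟨ cong (suc m ^ n *_) (^-*-assoc m (suc m) q) ⟨
      suc m ^ n * (m ^ suc m) ^ q  ∎)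
    where
    open ≤-Reasoning
    q = n / suc m
    [1+m]*q≤n : suc m * q ≤ n
    [1+m]*q≤n = ≤-trans (≤-reflexive (*-comm (suc m) q)) (m/n*n≤m n (suc m))

  -- The bounds e^⌊n/(i+1)⌋ ≤ ((i+1)/i)^n telescope.
  e^∑⌊n/[2+i]⌋≤[1+t]^n : ∀ n t → ExpFracLe (∑< t (λ i → n / suc (suc i))) 1 (suc t ^ n) 1
  e^∑⌊n/[2+i]⌋≤[1+t]^n n zero    = ExpFracLe-weaken (ExpFracLe-0 1) (≤-reflexive (cong (_* 1) (sym (^-zeroˡ n))))
  e^∑⌊n/[2+i]⌋≤[1+t]^n n (suc t) =
    subst (λ a → ExpFracLe a 1 (suc (suc t) ^ n) 1) (sym (∑<-last t (λ i → n / suc (suc i))))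
      (ExpFracLe-weaken {{m*n≢0 1 (suc t ^ n) {{_}} {{m^n≢0 (suc t) n}}}}
        (ExpFracLe-* (e^∑⌊n/[2+i]⌋≤[1+t]^n n t) (e^⌊n/[1+m]⌋≤[1+m]^n/m^n (suc t) n))
        (≤-reflexive (reorder (suc t ^ n) (suc (suc t) ^ n))))
    where
    reorder : ∀ x y → x * y * 1 ≡ y * (1 * x)
    reorder = solve-∀

  ExpFracLe⇒ExpLe : ∀ {k A} → ExpFracLe k 1 A 1 → ExpLe k A
  ExpFracLe⇒ExpLe {k} {A} bound j = begin
    expScaled k j       ≡⟨ expScaled≡expSum k j ⟩
    expSum k 1 j        ≡⟨ *-identityˡ _ ⟨
    1 * expSum k 1 j    ≤⟨ partialSum≤ bound j ⟩
    A * (1 ^ j * j !)   ≡⟨ cong (λ x → A * (x * j !)) (^-zeroˡ j) ⟩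
    A * (1 * j !)       ≡⟨ cong (A *_) (*-identityˡ (j !)) ⟩
    A * j !             ∎
    where open ≤-Reasoning

  expScaled-monoˡ-≤ : ∀ {k k′} → k ≤ k′ → ∀ j → expScaled k j ≤ expScaled k′ j
  expScaled-monoˡ-≤ k≤k′ zero    = ≤-refl
  expScaled-monoˡ-≤ k≤k′ (suc j) =
    +-mono-≤ (*-monoʳ-≤ (suc j) (expScaled-monoˡ-≤ k≤k′ j)) (^-monoˡ-≤ (suc j) k≤k′)

  LeNLog-antimono : ∀ {n s t} → LeNLog n s → t ≤ s → LeNLog n t
  LeNLog-antimono         (inj₁ s≤n) t≤s = inj₁ (≤-trans t≤s s≤n)
  LeNLog-antimono {n} (inj₂ e^[s-n]≤nⁿ) t≤s =
    inj₂ λ j → ≤-trans (expScaled-monoˡ-≤ (∸-monoˡ-≤ n t≤s) j) (e^[s-n]≤nⁿ j)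

  floorQuotients : ℕ → List ℕ
  floorQuotients n = applyUpTo (λ i → n / suc i) n

  -- ⌊n/1⌋ = n, and the remaining terms are controlled by the telescoping bound with t = n - 1.
  LeNLog-floorQuotients : ∀ n → LeNLog n (sum (floorQuotients n))
  LeNLog-floorQuotients zero        = inj₁ z≤n
  LeNLog-floorQuotients n@(suc n-1) = inj₂ (subst (λ a → ExpLe a (n ^ n)) (sym rest)
    (ExpFracLe⇒ExpLe (e^∑⌊n/[2+i]⌋≤[1+t]^n n n-1)))
    where
    rest : sum (floorQuotients n) ∸ n ≡ ∑< n-1 (λ i → n / suc (suc i))
    rest = trans (cong (λ x → x + ∑< n-1 (λ i → n / suc (suc i)) ∸ n) (n/1≡n n)) (m+n∸m≡n n _)

  sum-floorQuotients≤ : ∀ {n m} → IsFloorNLog n m → sum (floorQuotients n) ≤ m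
  sum-floorQuotients≤ {n} {m} (_ , ¬LeNLog[1+m]) with sum (floorQuotients n) ≤? m
  ... | yes ≤m = ≤m
  ... | no  ≰m = contradiction (LeNLog-antimono (LeNLog-floorQuotients n) (≰⇒> ≰m)) ¬LeNLog[1+m]

module GroupConstructions where

  open import Level using (Lift; lift; lower)
  open import Function.Bundles using (Inverse; Injection)
  open import Function.Properties.Inverse using (Inverse⇒Injection)
  open import Function.Construct.Composition using () renaming (inverse to ↔-trans)
  open import Function.Construct.Symmetry using () renaming (inverse to ↔-sym)
  open import Data.Nat
  open import Data.Nat.Properties
  open import Data.Nat.DivMod
    using (_%_; %-congʳ; m%n<n; m%n%n≡m%n; m<n⇒m%n≡m; %-distribˡ-+; %-distribˡ-*; m*n%n≡0; m%n*o≡m*o%[n*o])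
  open import Data.Fin.Base using (Fin; toℕ; fromℕ<)
  import Data.Fin.Properties as Fin
  open import Data.Product using (proj₁; proj₂)
  open import Data.Product.Relation.Binary.Pointwise.NonDependent using (Pointwise-≡↔≡)
  open import Data.Product.Function.NonDependent.Setoid using (_×-inverse_)
  open import Data.List.Relation.Binary.Prefix.Heterogeneous using (Prefix; []; _∷_)
  open import Relation.Binary.PropositionalEquality as ≡ using (_≡_)
  import Algebra.Construct.DirectProduct as DirectProduct
  import Algebra.Construct.Terminal as Terminal
  open import Algebra.Morphism.Structures using (module GroupMorphisms)
  import Algebra.Morphism.Construct.Composition as Hom

  module _ {c₁ ℓ₁ c₂ ℓ₂} {A : AbelianGroup c₁ ℓ₁} {B : AbelianGroup c₂ ℓ₂} where
    private
      module A = AbelianGroup A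
      module B = AbelianGroup B
    open import Algebra.Properties.Group B.group using (identityˡ-unique; inverseˡ-unique)

    mkEmbedding : (f : A.Carrier → B.Carrier) →
      (∀ {x y} → x A.≈ y → f x B.≈ f y) →
      (∀ x y → f (x A.∙ y) B.≈ f x B.∙ f y) →
      (∀ {x y} → f x B.≈ f y → x A.≈ y) →
      EmbedsInto A B
    mkEmbedding f cong homo injective = f , record
      { isGroupHomomorphism = record
        { isMonoidHomomorphism = record
          { isMagmaHomomorphism = record { isRelHomomorphism = record { cong = cong } ; homo = homo }
          ; ε-homo = ε-homo }
        ; ⁻¹-homo = λ x → inverseˡ-unique (f (x A.⁻¹)) (f x)
            (B.trans (B.sym (homo (x A.⁻¹) x)) (B.trans (cong (A.inverseˡ x)) ε-homo)) }
      ; injective = injective }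
      where
      ε-homo : f A.ε B.≈ B.ε
      ε-homo = identityˡ-unique (f A.ε) (f A.ε) (B.trans (B.sym (homo A.ε A.ε)) (cong (A.identityˡ A.ε)))

    HasOrder-≤ : ∀ {m n} → HasOrder A m → HasOrder B n → (f : A.Carrier → B.Carrier) →
      (∀ {x y} → f x B.≈ f y → x A.≈ y) → m ≤ n
    HasOrder-≤ ∣A∣≡m ∣B∣≡n f injective = Fin.injective⇒≤ {f = N.to ∘ f ∘ M.from} λ {i} {j} eq →
      ≡.trans (≡.sym (M.strictlyInverseˡ i)) (≡.trans (M.to-cong (injective (N.injective eq))) (M.strictlyInverseˡ j))
      where
      module M = Inverse ∣A∣≡m
      module N = Injection (Inverse⇒Injection ∣B∣≡n)

  module _ {c₁ ℓ₁ c₂ ℓ₂} {A : AbelianGroup c₁ ℓ₁} {B : AbelianGroup c₂ ℓ₂} where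
    private
      module A = AbelianGroup A
      module B = AbelianGroup B

    bijection⇒EmbedsInto : (f : A.Carrier → B.Carrier) →
      (∀ {x y} → x A.≈ y → f x B.≈ f y) →
      (∀ x y → f (x A.∙ y) B.≈ f x B.∙ f y) →
      (∀ {x y} → f x B.≈ f y → x A.≈ y) →
      (∀ y → Σ A.Carrier λ x → f x B.≈ y) →
      EmbedsInto B A
    bijection⇒EmbedsInto f cong homo injective surjective = mkEmbedding {A = B} {B = A} g
      (λ {y} {y′} y≈y′ → injective (B.trans (g-spec y) (B.trans y≈y′ (B.sym (g-spec y′)))))
      (λ y y′ → injective (B.trans (g-spec (y B.∙ y′))
                            (B.sym (B.trans (homo (g y) (g y′)) (B.∙-cong (g-spec y) (g-spec y′))))))
      (λ {y} {y′} gy≈gy′ → B.trans (B.sym (g-spec y)) (B.trans (cong gy≈gy′) (g-spec y′)))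
      where
      g : B.Carrier → A.Carrier
      g y = proj₁ (surjective y)
      g-spec : ∀ y → f (g y) B.≈ y
      g-spec y = proj₂ (surjective y)

  EmbedsInto-trans : ∀ {c₁ ℓ₁ c₂ ℓ₂ c₃ ℓ₃}
    {A : AbelianGroup c₁ ℓ₁} {B : AbelianGroup c₂ ℓ₂} {C : AbelianGroup c₃ ℓ₃} →
    EmbedsInto A B → EmbedsInto B C → EmbedsInto A C
  EmbedsInto-trans {C = C} (f , f-mono) (g , g-mono) = g ∘ f , Hom.isGroupMonomorphism (AbelianGroup.trans C) f-mono g-mono

  module _ {c ℓ : Level} where

    infixr 2 _⊕_
    _⊕_ : AbelianGroup c ℓ → AbelianGroup c ℓ → AbelianGroup c ℓ
    _⊕_ = DirectProduct.abelianGroup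

    trivial : AbelianGroup c ℓ
    trivial = Terminal.abelianGroup

    EmbedsInto-⊕ : ∀ {A A′ B B′ : AbelianGroup c ℓ} →
      EmbedsInto A A′ → EmbedsInto B B′ → EmbedsInto (A ⊕ B) (A′ ⊕ B′)
    EmbedsInto-⊕ {A} {A′} {B} {B′} (f , f-mono) (g , g-mono) =
      mkEmbedding {A = A ⊕ B} {B = A′ ⊕ B′} (λ (x , y) → f x , g y)
      (λ (x≈ , y≈) → F.⟦⟧-cong x≈ , G.⟦⟧-cong y≈)
      (λ (x , y) (x′ , y′) → F.∙-homo x x′ , G.∙-homo y y′)
      (λ (fx≈ , gy≈) → F.injective fx≈ , G.injective gy≈)
      where
      module F = GroupMorphisms.IsGroupMonomorphism f-mono
      module G = GroupMorphisms.IsGroupMonomorphism g-mono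

    trivial-EmbedsInto : ∀ (A : AbelianGroup c ℓ) → EmbedsInto trivial A
    trivial-EmbedsInto A = mkEmbedding {A = trivial} {B = A} (λ _ → ε) (λ _ → refl) (λ _ _ → sym (identityˡ ε)) (λ _ → _)
      where open AbelianGroup A

    HasOrder-⊕ : ∀ {A B : AbelianGroup c ℓ} {m n} → HasOrder A m → HasOrder B n → HasOrder (A ⊕ B) (m * n)
    HasOrder-⊕ ∣A∣≡m ∣B∣≡n = ↔-trans (∣A∣≡m ×-inverse ∣B∣≡n) (↔-trans Pointwise-≡↔≡ (↔-sym Fin.*↔×))

    HasOrder-trivial : HasOrder trivial 1
    HasOrder-trivial = record
      { to = λ _ → Fin.zero ; from = _ ; to-cong = λ _ → ≡.refl ; from-cong = _
      ; inverse = (λ { {Fin.zero} _ → ≡.refl }) , _ }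

    infix 5 ℤ/_
    ℤ/_ : (m : ℕ) .{{_ : NonZero m}} → AbelianGroup c ℓ
    ℤ/ m = record
      { Carrier = Lift c ℕ
      ; _≈_ = λ x y → Lift ℓ (lower x % m ≡ lower y % m)
      ; _∙_ = λ x y → lift (lower x + lower y)
      ; ε = lift 0
      ; _⁻¹ = λ x → lift (lower x * (m ∸ 1))
      ; isAbelianGroup = record
        { isGroup = record
          { isMonoid = record
            { isSemigroup = record
              { isMagma = record
                { isEquivalence = record
                  { refl = lift ≡.refl
                  ; sym = λ (lift x≡y) → lift (≡.sym x≡y)
                  ; trans = λ (lift x≡y) (lift y≡z) → lift (≡.trans x≡y y≡z) }
                ; ∙-cong = λ (lift x≡y) (lift u≡v) → lift (+-cong-mod x≡y u≡v) }
              ; assoc = λ x y z → lift (≡.cong (_% m) (+-assoc (lower x) (lower y) (lower z))) }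
            ; identity = (λ _ → lift ≡.refl) , (λ x → lift (≡.cong (_% m) (+-identityʳ (lower x)))) }
          ; inverse = (λ x → lift (x*[m∸1]+x≡0 (lower x)))
                    , (λ x → lift (≡.trans (≡.cong (_% m) (+-comm (lower x) _)) (x*[m∸1]+x≡0 (lower x))))
          ; ⁻¹-cong = λ (lift x≡y) → lift (*[m∸1]-cong-mod x≡y) }
        ; comm = λ x y → lift (≡.cong (_% m) (+-comm (lower x) (lower y))) } }
      where
      +-cong-mod : ∀ {x y u v} → x % m ≡ y % m → u % m ≡ v % m → (x + u) % m ≡ (y + v) % m
      +-cong-mod {x} {y} {u} {v} x≡y u≡v = begin
        (x + u) % m             ≡⟨ %-distribˡ-+ x u m ⟩
        (x % m + u % m) % m     ≡⟨ ≡.cong₂ (λ a b → (a + b) % m) x≡y u≡v ⟩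
        (y % m + v % m) % m     ≡⟨ %-distribˡ-+ y v m ⟨
        (y + v) % m             ∎
        where open ≡.≡-Reasoning
      *[m∸1]-cong-mod : ∀ {x y} → x % m ≡ y % m → (x * (m ∸ 1)) % m ≡ (y * (m ∸ 1)) % m
      *[m∸1]-cong-mod {x} {y} x≡y = begin
        (x * (m ∸ 1)) % m                 ≡⟨ %-distribˡ-* x (m ∸ 1) m ⟩
        (x % m * ((m ∸ 1) % m)) % m       ≡⟨ ≡.cong (λ a → (a * ((m ∸ 1) % m)) % m) x≡y ⟩
        (y % m * ((m ∸ 1) % m)) % m       ≡⟨ %-distribˡ-* y (m ∸ 1) m ⟨
        (y * (m ∸ 1)) % m                 ∎
        where open ≡.≡-Reasoning
      x*[m∸1]+x≡0 : ∀ x → (x * (m ∸ 1) + x) % m ≡ 0 % m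
      x*[m∸1]+x≡0 x = begin
        (x * (m ∸ 1) + x) % m     ≡⟨ ≡.cong (λ a → (x * (m ∸ 1) + a) % m) (*-identityʳ x) ⟨
        (x * (m ∸ 1) + x * 1) % m ≡⟨ ≡.cong (_% m) (*-distribˡ-+ x (m ∸ 1) 1) ⟨
        (x * (m ∸ 1 + 1)) % m     ≡⟨ ≡.cong (λ a → (x * a) % m) (m∸n+n≡m (>-nonZero⁻¹ m)) ⟩
        (x * m) % m               ≡⟨ m*n%n≡0 x m ⟩
        0                         ≡⟨ m<n⇒m%n≡m (>-nonZero⁻¹ m) ⟨
        0 % m                     ∎
        where open ≡.≡-Reasoning

    HasOrder-ℤ/ : ∀ m .{{_ : NonZero m}} → HasOrder (ℤ/ m) m
    HasOrder-ℤ/ m = record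
      { to        = to
      ; from      = λ i → lift (toℕ i)
      ; to-cong   = λ {x} {y} (lift x≡y) → Fin.fromℕ<-cong _ _ x≡y (m%n<n (lower x) m) (m%n<n (lower y) m)
      ; from-cong = λ { ≡.refl → lift ≡.refl }
      ; inverse   = (λ { (lift x≡i) → to≡ x≡i }) , (λ { {x} ≡.refl → lift (from-to x) })
      }
      where
      to : Lift c ℕ → Fin m
      to x = fromℕ< (m%n<n (lower x) m)
      to≡ : ∀ {i x} → lower x % m ≡ toℕ i % m → to x ≡ i
      to≡ {i} x≡i = ≡.trans (Fin.fromℕ<-cong _ _ (≡.trans x≡i (m<n⇒m%n≡m (Fin.toℕ<n i))) _ (Fin.toℕ<n i))
                            (Fin.fromℕ<-toℕ i (Fin.toℕ<n i))
      from-to : ∀ x → toℕ (to x) % m ≡ lower x % m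
      from-to x = ≡.trans (≡.cong (_% m) (Fin.toℕ-fromℕ< (m%n<n (lower x) m))) (m%n%n≡m%n (lower x) m)

    ℤ/-EmbedsInto : ∀ m n k .{{_ : NonZero m}} .{{_ : NonZero n}} .{{_ : NonZero k}} → m * k ≡ n → EmbedsInto (ℤ/ m) (ℤ/ n)
    ℤ/-EmbedsInto m n k m*k≡n = mkEmbedding {A = ℤ/ m} {B = ℤ/ n} (λ x → lift (lower x * k))
      (λ {x} {y} (lift x≡y) → lift (≡.trans (scaled-mod (lower x))
                                      (≡.trans (≡.cong (_* k) x≡y) (≡.sym (scaled-mod (lower y))))))
      (λ x y → lift (≡.cong (_% n) (*-distribʳ-+ k (lower x) (lower y))))
      (λ {x} {y} (lift xk≡yk) → lift (*-cancelʳ-≡ _ _ k (≡.trans (≡.sym (scaled-mod (lower x)))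
                                                          (≡.trans xk≡yk (scaled-mod (lower y))))))
      where
      instance
        _ : NonZero (m * k)
        _ = m*n≢0 m k
      scaled-mod : ∀ x → (x * k) % n ≡ x % m * k
      scaled-mod x = ≡.trans (%-congʳ (≡.sym m*k≡n)) (≡.sym (m%n*o≡m*o%[n*o] x m k))

  module _ {c ℓ : Level} (p : ℕ) .{{_ : NonZero p}} where

    ℤ/p^ : ℕ → AbelianGroup c ℓ
    ℤ/p^ a = (ℤ/ p ^ a) {{m^n≢0 p a}}

    ⊕ℤ/p^ : List ℕ → AbelianGroup c ℓ
    ⊕ℤ/p^ []       = trivial
    ⊕ℤ/p^ (a ∷ as) = ℤ/p^ a ⊕ ⊕ℤ/p^ as

    HasOrder-⊕ℤ/p^ : ∀ as → HasOrder (⊕ℤ/p^ as) (p ^ sum as)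
    HasOrder-⊕ℤ/p^ []       = HasOrder-trivial
    HasOrder-⊕ℤ/p^ (a ∷ as) = ≡.subst (HasOrder (⊕ℤ/p^ (a ∷ as))) (≡.sym (^-distribˡ-+-* p a (sum as)))
      (HasOrder-⊕ {A = ℤ/p^ a} {⊕ℤ/p^ as} (HasOrder-ℤ/ (p ^ a) {{m^n≢0 p a}}) (HasOrder-⊕ℤ/p^ as))

    ⊕ℤ/p^-EmbedsInto : ∀ {as bs} → Prefix _≤_ as bs → EmbedsInto (⊕ℤ/p^ as) (⊕ℤ/p^ bs)
    ⊕ℤ/p^-EmbedsInto {bs = bs} []                  = trivial-EmbedsInto (⊕ℤ/p^ bs)
    ⊕ℤ/p^-EmbedsInto {a ∷ as} {b ∷ bs} (a≤b ∷ as≤bs) = EmbedsInto-⊕ {A = ℤ/p^ a} {ℤ/p^ b} {⊕ℤ/p^ as} {⊕ℤ/p^ bs}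
      (ℤ/-EmbedsInto (p ^ a) (p ^ b) (p ^ (b ∸ a)) {{m^n≢0 p a}} {{m^n≢0 p b}} {{m^n≢0 p (b ∸ a)}}
        (≡.trans (≡.sym (^-distribˡ-+-* p a (b ∸ a))) (≡.cong (p ^_) (m+[n∸m]≡n a≤b))))
      (⊕ℤ/p^-EmbedsInto as≤bs)

module IntegerMultiples where

  open import Level using (_⊔_)
  open import Data.Nat as ℕ using (zero)
  open import Data.Nat.DivMod using (_%_; m≡m%n+[m/n]*n)
  open import Data.Nat.Coprimality using (Coprime; coprime-Bézout)
  open import Data.Nat.GCD using (module Bézout)
  open import Relation.Binary.Core using (Rel)

  module Multiples {c ℓ} (Q : AbelianGroup c ℓ) where
    open AbelianGroup Q
    open import Algebra.Definitions.RawMonoid rawMonoid public using () renaming (_×_ to infixr 7.5 _·_)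
    open import Algebra.Properties.Monoid.Mult monoid public using ()
      renaming (×-congʳ to ·-congʳ; ×-homo-+ to ·-homo-+; ×-assocˡ to ·-assocˡ; ×-homo-1 to ·-homo-1)
    open import Algebra.Properties.CommutativeMonoid.Mult commutativeMonoid public using ()
      renaming (×-distrib-+ to ·-distrib-∙)
    open import Algebra.Properties.AbelianGroup Q using (⁻¹-∙-comm)
    open import Algebra.Properties.Group group using (ε⁻¹≈ε)
    open import Relation.Binary.Reasoning.Setoid setoid

    Annihilates : ℕ → Carrier → Set ℓ
    Annihilates n x = n · x ≈ ε

    AnnihilatedBy : ℕ → Set (c ⊔ ℓ)
    AnnihilatedBy n = ∀ x → Annihilates n x

    ·-≡ : ∀ {m n} x → m ≡.≡ n → m · x ≈ n · x
    ·-≡ x ≡.refl = refl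

    ·-ε : ∀ n → n · ε ≈ ε
    ·-ε zero    = refl
    ·-ε (suc n) = trans (identityˡ (n · ε)) (·-ε n)

    ·-⁻¹ : ∀ n x → n · (x ⁻¹) ≈ (n · x) ⁻¹
    ·-⁻¹ zero    x = sym ε⁻¹≈ε
    ·-⁻¹ (suc n) x = trans (∙-congˡ (·-⁻¹ n x)) (⁻¹-∙-comm x (n · x))

    ·-annihilated : ∀ {M g} → M · g ≈ ε → ∀ k → (k ℕ.* M) · g ≈ ε
    ·-annihilated {M} {g} Mg≈ε k = trans (sym (·-assocˡ g k M)) (trans (·-congʳ k Mg≈ε) (·-ε k))

    ·-% : ∀ {M g} .{{_ : NonZero M}} → M · g ≈ ε → ∀ x → x · g ≈ (x % M) · g
    ·-% {M} {g} Mg≈ε x = begin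
      x · g                                  ≈⟨ ·-≡ g (m≡m%n+[m/n]*n x M) ⟩
      (x % M ℕ.+ (x / M) ℕ.* M) · g          ≈⟨ ·-homo-+ g (x % M) _ ⟩
      (x % M) · g ∙ ((x / M) ℕ.* M) · g      ≈⟨ ∙-congˡ (·-annihilated Mg≈ε (x / M)) ⟩
      (x % M) · g ∙ ε                        ≈⟨ identityʳ _ ⟩
      (x % M) · g                            ∎

    k·g∙k[M∸1]·g≈ε : ∀ {M g} .{{_ : NonZero M}} → M · g ≈ ε → ∀ k → k · g ∙ (k ℕ.* (M ∸ 1)) · g ≈ ε
    k·g∙k[M∸1]·g≈ε {M} {g} Mg≈ε k = begin
      k · g ∙ (k ℕ.* (M ∸ 1)) · g      ≈⟨ ·-homo-+ g k _ ⟨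
      (k ℕ.+ k ℕ.* (M ∸ 1)) · g        ≈⟨ ·-≡ g k+k[M-1]≡kM ⟩
      (k ℕ.* M) · g                    ≈⟨ ·-annihilated Mg≈ε k ⟩
      ε                                ∎
      where
      k+k[M-1]≡kM : k ℕ.+ k ℕ.* (M ∸ 1) ≡.≡ k ℕ.* M
      k+k[M-1]≡kM = ≡.trans (≡.sym (ℕ.*-suc k (M ∸ 1))) (≡.cong (k ℕ.*_) (ℕ.suc-pred M))

    consecutive-annihilators : ∀ {a b h} → suc a ≡.≡ b → a · h ≈ ε → b · h ≈ ε → h ≈ ε
    consecutive-annihilators {a} {b} {h} 1+a≡b ah≈ε bh≈ε = begin
      h               ≈⟨ identityʳ h ⟨
      h ∙ ε           ≈⟨ ∙-congˡ ah≈ε ⟨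
      h ∙ a · h       ≈⟨ ·-≡ h 1+a≡b ⟩
      b · h           ≈⟨ bh≈ε ⟩
      ε               ∎

    coprime-annihilators : ∀ {m n h} → Coprime m n → m · h ≈ ε → n · h ≈ ε → h ≈ ε
    coprime-annihilators m⊥n mh≈ε nh≈ε with coprime-Bézout m⊥n
    ... | Bézout.+- x y 1+yn≡xm = consecutive-annihilators 1+yn≡xm (·-annihilated nh≈ε y) (·-annihilated mh≈ε x)
    ... | Bézout.-+ x y 1+xm≡yn = consecutive-annihilators 1+xm≡yn (·-annihilated mh≈ε x) (·-annihilated nh≈ε y)

  module CyclicQuotient {c ℓ} (Q : AbelianGroup c ℓ) (g : AbelianGroup.Carrier Q)
    (M : ℕ) .{{_ : NonZero M}} (Mg≈ε : Multiples.Annihilates Q M g) where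

    open AbelianGroup Q
    open Multiples Q

    open import Algebra.Properties.CommutativeSemigroup commutativeSemigroup using (interchange)
    open import Algebra.Properties.Group group using (inverseʳ-unique)
    open import Relation.Binary.Reasoning.Setoid setoid

    infix 4 _≈⟨g⟩_
    _≈⟨g⟩_ : Rel Carrier ℓ
    x ≈⟨g⟩ y = Σ ℕ λ k → x ≈ y ∙ k · g

    ≈⇒≈⟨g⟩ : ∀ {x y} → x ≈ y → x ≈⟨g⟩ y
    ≈⇒≈⟨g⟩ {x} {y} x≈y = 0 , trans x≈y (sym (identityʳ y))

    ⁻¹-· : ∀ k → (k · g) ⁻¹ ≈ (k ℕ.* (M ∸ 1)) · g
    ⁻¹-· k = sym (inverseʳ-unique (k · g) _ (k·g∙k[M∸1]·g≈ε Mg≈ε k))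

    sym⟨g⟩ : ∀ {x y} → x ≈⟨g⟩ y → y ≈⟨g⟩ x
    sym⟨g⟩ {x} {y} (k , x≈y+kg) = k ℕ.* (M ∸ 1) , (begin
      y                                   ≈⟨ identityʳ y ⟨
      y ∙ ε                               ≈⟨ ∙-congˡ (k·g∙k[M∸1]·g≈ε Mg≈ε k) ⟨
      y ∙ (k · g ∙ (k ℕ.* (M ∸ 1)) · g)   ≈⟨ assoc y _ _ ⟨
      y ∙ k · g ∙ (k ℕ.* (M ∸ 1)) · g     ≈⟨ ∙-congʳ x≈y+kg ⟨
      x ∙ (k ℕ.* (M ∸ 1)) · g             ∎)

    trans⟨g⟩ : ∀ {x y z} → x ≈⟨g⟩ y → y ≈⟨g⟩ z → x ≈⟨g⟩ z
    trans⟨g⟩ {x} {y} {z} (k , x≈y+kg) (l , y≈z+lg) = l ℕ.+ k , (begin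
      x                   ≈⟨ x≈y+kg ⟩
      y ∙ k · g           ≈⟨ ∙-congʳ y≈z+lg ⟩
      z ∙ l · g ∙ k · g   ≈⟨ assoc z _ _ ⟩
      z ∙ (l · g ∙ k · g) ≈⟨ ∙-congˡ (·-homo-+ g l k) ⟨
      z ∙ (l ℕ.+ k) · g   ∎)

    ∙-cong⟨g⟩ : ∀ {x x′ y y′} → x ≈⟨g⟩ x′ → y ≈⟨g⟩ y′ → x ∙ y ≈⟨g⟩ x′ ∙ y′
    ∙-cong⟨g⟩ {x} {x′} {y} {y′} (k , x≈) (l , y≈) = k ℕ.+ l , (begin
      x ∙ y                       ≈⟨ ∙-cong x≈ y≈ ⟩
      (x′ ∙ k · g) ∙ (y′ ∙ l · g) ≈⟨ interchange x′ _ y′ _ ⟩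
      (x′ ∙ y′) ∙ (k · g ∙ l · g) ≈⟨ ∙-congˡ (·-homo-+ g k l) ⟨
      (x′ ∙ y′) ∙ (k ℕ.+ l) · g   ∎)

    ⁻¹-cong⟨g⟩ : ∀ {x y} → x ≈⟨g⟩ y → x ⁻¹ ≈⟨g⟩ y ⁻¹
    ⁻¹-cong⟨g⟩ {x} {y} (k , x≈y+kg) = k ℕ.* (M ∸ 1) , (begin
      x ⁻¹                          ≈⟨ ⁻¹-cong x≈y+kg ⟩
      (y ∙ k · g) ⁻¹                ≈⟨ ⁻¹-∙-comm y (k · g) ⟨
      y ⁻¹ ∙ (k · g) ⁻¹             ≈⟨ ∙-congˡ (⁻¹-· k) ⟩
      y ⁻¹ ∙ (k ℕ.* (M ∸ 1)) · g    ∎)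
      where open import Algebra.Properties.AbelianGroup Q using (⁻¹-∙-comm)

    quotient : AbelianGroup c ℓ
    quotient = record
      { Carrier = Carrier
      ; _≈_ = _≈⟨g⟩_
      ; _∙_ = _∙_
      ; ε = ε
      ; _⁻¹ = _⁻¹
      ; isAbelianGroup = record
        { isGroup = record
          { isMonoid = record
            { isSemigroup = record
              { isMagma = record
                { isEquivalence = record { refl = ≈⇒≈⟨g⟩ refl ; sym = sym⟨g⟩ ; trans = trans⟨g⟩ }
                ; ∙-cong = ∙-cong⟨g⟩ }
              ; assoc = λ x y z → ≈⇒≈⟨g⟩ (assoc x y z) }
            ; identity = (λ x → ≈⇒≈⟨g⟩ (identityˡ x)) , (λ x → ≈⇒≈⟨g⟩ (identityʳ x)) }
          ; inverse = (λ x → ≈⇒≈⟨g⟩ (inverseˡ x)) , (λ x → ≈⇒≈⟨g⟩ (inverseʳ x))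
          ; ⁻¹-cong = ⁻¹-cong⟨g⟩ }
        ; comm = λ x y → ≈⇒≈⟨g⟩ (comm x y) } }

    ·⟨g⟩≡· : ∀ n x → Multiples._·_ quotient n x ≡.≡ n · x
    ·⟨g⟩≡· zero    x = ≡.refl
    ·⟨g⟩≡· (suc n) x = ≡.cong (x ∙_) (·⟨g⟩≡· n x)

module Partitions where

  open import Data.Nat
  open import Data.Nat.Properties
  open import Data.Nat.DivMod using (m*n/n≡m; /-monoˡ-≤)
  open import Data.List.Base using (applyUpTo)
  open import Data.List.Relation.Binary.Prefix.Heterogeneous using (Prefix; []; _∷_)
  open import Relation.Binary.PropositionalEquality
  open import Relation.Nullary using (contradiction)
  open import Algebra.Properties.CommutativeSemigroup +-commutativeSemigroup using (x∙yz≈y∙xz)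

  data PartitionBelow : ℕ → List ℕ → Set where
    []   : ∀ {s} → PartitionBelow s []
    part : ∀ {s a as} → 0 < a → a ≤ s → PartitionBelow a as → PartitionBelow s (a ∷ as)

  -- In a non-increasing partition of at most n, i · aᵢ ≤ a₁ + … + aᵢ ≤ n, so aᵢ ≤ ⌊n/i⌋. The statement is
  -- generalised to the parts as that follow i parts, each at least s.
  partition-fits : ∀ {n s as} (f : ℕ → ℕ) i t {rest} → PartitionBelow s as → i * s + sum as ≤ n → n ≤ i + t →
    (∀ j → n / suc (i + j) ≤ f j) → Prefix _≤_ as (applyUpTo f t ++ rest)
  partition-fits f i t       []                        _     _      _     = []
  partition-fits {n} {s} f i zero (part {a = a} {as} 0<a a≤s _) fits n≤i _ = contradiction (begin-strict
    n                      ≤⟨ n≤i ⟩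
    i + 0                  <⟨ +-mono-≤-< (≤-trans (≤-reflexive (sym (*-identityʳ i))) (*-monoʳ-≤ i 1≤s)) 0<a ⟩
    i * s + a              ≤⟨ +-monoʳ-≤ (i * s) (m≤m+n a (sum as)) ⟩
    i * s + (a + sum as)   ≤⟨ fits ⟩
    n                      ∎) (<-irrefl refl)
    where
    open ≤-Reasoning
    1≤s = ≤-trans 0<a a≤s
  partition-fits {n} {s} f i (suc t) (part {a = a} {as} 0<a a≤s partition) fits n≤i+1+t f-bound =
    ≤-trans a≤n/[1+i] (≤-trans (≤-reflexive (cong (λ k → n / suc k) (sym (+-identityʳ i)))) (f-bound 0))
    ∷ partition-fits (f ∘ suc) (suc i) t partition fits′ (≤-trans n≤i+1+t (≤-reflexive (+-suc i t)))
        (λ j → ≤-trans (≤-reflexive (cong (λ k → n / suc k) (sym (+-suc i j)))) (f-bound (suc j)))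
    where
    open ≤-Reasoning
    fits′ : suc i * a + sum as ≤ n
    fits′ = begin
      suc i * a + sum as        ≡⟨ +-assoc a (i * a) (sum as) ⟩
      a + (i * a + sum as)      ≡⟨ x∙yz≈y∙xz a (i * a) (sum as) ⟩
      i * a + (a + sum as)      ≤⟨ +-monoˡ-≤ (a + sum as) (*-monoʳ-≤ i a≤s) ⟩
      i * s + (a + sum as)      ≤⟨ fits ⟩
      n                         ∎
    a*[1+i]≤n : a * suc i ≤ n
    a*[1+i]≤n = ≤-trans (≤-reflexive (*-comm a (suc i))) (≤-trans (m≤m+n (suc i * a) (sum as)) fits′)
    a≤n/[1+i] : a ≤ n / suc i
    a≤n/[1+i] = begin
      a                   ≡⟨ m*n/n≡m a (suc i) ⟨
      a * suc i / suc i   ≤⟨ /-monoˡ-≤ (suc i) a*[1+i]≤n ⟩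
      n / suc i           ∎

module PGroupStructure where

  open import Level using (_⊔_; lift; lower)
  open import Function.Bundles using (Inverse; Injection)
  open import Function.Properties.Inverse using (Inverse⇒Injection)
  open import Data.Vec.Functional using (replicate)
  open import Data.Fin.Permutation using (permutation)
  import Relation.Nullary.Decidable as Dec
  open import Data.Nat as ℕ using (zero; _<_; z≤n; s≤s)
  open import Data.Nat.DivMod using (_%_; m%n<n; %-remove-+ʳ)
  open import Data.Nat.Divisibility using (_∣_; divides; _∣?_; *-pres-∣; ∣-refl; *-cancelˡ-∣)
  open import Data.Nat.Primality using (prime⇒nonTrivial; prime⇒irreducible)
  open import Data.Nat.Coprimality using (Coprime)
  open import Data.Fin.Base using (Fin; toℕ; fromℕ<)
  import Data.Fin.Properties as Fin
  open import Data.Fin.Subset using (Subset; _⊂_; _⊃_; _∈_)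
  open import Data.Fin.Subset.Induction using (Acc; acc; ⊃-wellFounded)
  open import Data.Vec.Base using (Vec; []; _∷_; tabulate)
  import Data.Vec.Properties as Vec
  open import Data.List.Base using (length)
  open import Data.Product using (proj₁; proj₂)
  open import Data.Unit.Polymorphic using (⊤)
  open import Data.Vec.Relation.Binary.Pointwise.Inductive using (Pointwise; []; _∷_)
  open import Data.Sum using (_⊎_; inj₁; inj₂; [_,_]′)
  import Data.Sum
  open import Relation.Nullary using (¬_; Dec; yes; no; does; contradiction)
  open import Relation.Nullary.Decidable using (dec-true; dec-false; decidable-stable)
  open import Relation.Binary.Definitions using (Decidable)
  import Relation.Binary.PropositionalEquality as ≡
  open GroupConstructions
  open IntegerMultiples
  open Partitions using (PartitionBelow; []; part)

  record Enumeration {c ℓ} (Q : AbelianGroup c ℓ) (N : ℕ) : Set (c ⊔ ℓ) where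
    open AbelianGroup Q
    field
      enum            : Fin N → Carrier
      enum-surjective : ∀ x → Σ (Fin N) λ i → enum i ≈ x
      _≟_             : Decidable _≈_

    -- Quotienting by a nontrivial cyclic subgroup strictly enlarges zeros; this makes decompose terminate.
    zeros : Subset N
    zeros = tabulate λ i → does (enum i ≟ ε)

    ∈-zeros : ∀ {i} → enum i ≈ ε → i ∈ zeros
    ∈-zeros {i} i≈ε = Vec.lookup⇒[]= i zeros (≡.trans (Vec.lookup∘tabulate _ i) (dec-true (enum i ≟ ε) i≈ε))

    ∈-zeros⁻¹ : ∀ {i} → i ∈ zeros → enum i ≈ ε
    ∈-zeros⁻¹ {i} i∈zeros = decidable-stable (enum i ≟ ε) λ i≉ε →
      contradiction (≡.trans (≡.sym (dec-false (enum i ≟ ε) i≉ε))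
                             (≡.trans (≡.sym (Vec.lookup∘tabulate _ i)) (Vec.[]=⇒lookup i∈zeros))) λ ()

    module _ {q} {P : Carrier → Set q} (P-resp : ∀ {x y} → x ≈ y → P x → P y) (P? : ∀ x → Dec (P x)) where

      all? : Dec (∀ x → P x)
      all? with Fin.all? (P? ∘ enum)
      ... | yes ∀P = yes λ x → let (i , i≈x) = enum-surjective x in P-resp i≈x (∀P i)
      ... | no ¬∀P = no λ ∀P → ¬∀P (∀P ∘ enum)

      ¬∀⇒∃¬ : ¬ (∀ x → P x) → Σ Carrier λ x → ¬ P x
      ¬∀⇒∃¬ ¬∀P = let (i , ¬Pi) = Fin.¬∀⟶∃¬ N (P ∘ enum) (P? ∘ enum) (¬∀P ∘ lift-∀) in enum i , ¬Pi
        where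
        lift-∀ : (∀ i → P (enum i)) → ∀ x → P x
        lift-∀ ∀P x = let (i , i≈x) = enum-surjective x in P-resp i≈x (∀P i)

  module _ {c ℓ} {H : AbelianGroup c ℓ} {N} (∣H∣≡N : HasOrder H N) where
    open AbelianGroup H
    open Multiples H
    open Inverse ∣H∣≡N using (to; from; to-cong; strictlyInverseˡ; strictlyInverseʳ)
    private
      to-injective : ∀ {x y} → to x ≡.≡ to y → x ≈ y
      to-injective = Injection.injective (Inverse⇒Injection ∣H∣≡N)

    enumeration : Enumeration H N
    enumeration = record
      { enum            = from
      ; enum-surjective = λ x → to x , strictlyInverseʳ x
      ; _≟_             = λ x y → Dec.map′ to-injective to-cong (to x Fin.≟ to y)
      }

    -- Translation by x permutes H, so N · x ∙ Σ H = Σ (x ∙ H) = Σ H.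
    lagrange : AnnihilatedBy N
    lagrange x = identityˡ-unique (N · x) (∑ from) (begin
      N · x ∙ ∑ from                ≈⟨ ∙-congʳ (sum-replicate N) ⟨
      ∑ (replicate N x) ∙ ∑ from    ≈⟨ ∑-distrib-+ (replicate N x) from ⟨
      ∑ (λ i → x ∙ from i)          ≈⟨ sum-cong-≋ (λ i → sym (strictlyInverseʳ (x ∙ from i))) ⟩
      ∑ (from ∘ translate x)        ≈⟨ sum-permute from (permutation (translate x) (translate (x ⁻¹))
                                           (translate-cancel x (x ⁻¹) (inverseʳ x)) (translate-cancel (x ⁻¹) x (inverseˡ x))) ⟨
      ∑ from                        ∎)
      where
      open import Algebra.Properties.CommutativeMonoid.Sum commutativeMonoid
        using (sum-replicate; ∑-distrib-+; sum-cong-≋; sum-permute) renaming (sum to ∑)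
      open import Algebra.Properties.Group group using (identityˡ-unique)
      open import Relation.Binary.Reasoning.Setoid setoid
      translate : Carrier → Fin N → Fin N
      translate y i = to (y ∙ from i)
      translate-cancel : ∀ y z → y ∙ z ≈ ε → ∀ i → translate y (translate z i) ≡.≡ i
      translate-cancel y z y∙z≈ε i = ≡.trans (to-cong (begin
        y ∙ from (to (z ∙ from i))  ≈⟨ ∙-congˡ (strictlyInverseʳ (z ∙ from i)) ⟩
        y ∙ (z ∙ from i)            ≈⟨ assoc y z (from i) ⟨
        y ∙ z ∙ from i              ≈⟨ ∙-congʳ y∙z≈ε ⟩
        ε ∙ from i                  ≈⟨ identityˡ (from i) ⟩
        from i                      ∎)) (strictlyInverseˡ i)

  module QuotientEnumeration {c ℓ} {Q : AbelianGroup c ℓ} {N} (E : Enumeration Q N) (g : AbelianGroup.Carrier Q)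
    (M : ℕ) .{{_ : NonZero M}} (Mg≈ε : Multiples.Annihilates Q M g) where

    open AbelianGroup Q
    open Multiples Q
    open CyclicQuotient Q g M Mg≈ε
    open Enumeration E

    -- Multiples of g are periodic with period M, so the search for k in x ≈ y ∙ k · g is finite.
    _≟⟨g⟩_ : Decidable _≈⟨g⟩_
    x ≟⟨g⟩ y with Fin.any? (λ (k : Fin M) → x ≟ (y ∙ toℕ k · g))
    ... | yes (k , x≈y∙kg) = yes (toℕ k , x≈y∙kg)
    ... | no ∄k            = no λ (k , x≈y∙kg) → ∄k (fromℕ< (m%n<n k M) , trans x≈y∙kg (∙-congˡ
                               (trans (·-% Mg≈ε k) (·-≡ g (≡.sym (Fin.toℕ-fromℕ< (m%n<n k M)))))))

    quotientEnumeration : Enumeration quotient N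
    quotientEnumeration = record
      { enum            = enum
      ; enum-surjective = λ x → let (i , i≈x) = enum-surjective x in i , ≈⇒≈⟨g⟩ i≈x
      ; _≟_             = _≟⟨g⟩_
      }

    zeros⊂ : ¬ g ≈ ε → zeros ⊂ Enumeration.zeros quotientEnumeration
    zeros⊂ g≉ε = (λ j∈zeros → Enumeration.∈-zeros quotientEnumeration (≈⇒≈⟨g⟩ (∈-zeros⁻¹ j∈zeros)))
               , i , Enumeration.∈-zeros quotientEnumeration i≈⟨g⟩ε
               , (λ i∈zeros → g≉ε (trans (sym i≈g) (∈-zeros⁻¹ i∈zeros)))
      where
      i = proj₁ (enum-surjective g)
      i≈g = proj₂ (enum-surjective g)
      i≈⟨g⟩ε : enum i ≈⟨g⟩ ε
      i≈⟨g⟩ε = 1 , trans i≈g (trans (sym (·-homo-1 g)) (sym (identityˡ (1 · g))))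

  module _ {c ℓ : Level} {p : ℕ} (p-prime : Prime p) where

    private instance
      p-nonZero : NonZero p
      p-nonZero = prime⇒nonZero p-prime

    prime∤⇒coprime : ∀ {x} → ¬ (p ∣ x) → Coprime p x
    prime∤⇒coprime p∤x (d∣p , d∣x) with prime⇒irreducible p-prime d∣p
    ... | inj₁ d≡1      = d≡1
    ... | inj₂ ≡.refl   = contradiction d∣x p∤x

    module Order (Q : AbelianGroup c ℓ) where
      open AbelianGroup Q
      open Multiples Q
      open import Relation.Binary.Reasoning.Setoid setoid
      open import Algebra.Properties.Group group using (identityʳ-unique)

      p^n·p·g≈p^[1+n]·g : ∀ n g → p ℕ.^ n · (p · g) ≈ p ℕ.^ suc n · g
      p^n·p·g≈p^[1+n]·g n g = trans (·-assocˡ g (p ℕ.^ n) p) (·-≡ g (ℕ.*-comm (p ℕ.^ n) p))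

      -- If p ∤ x, then p^a · g is annihilated by the coprime numbers p and x; otherwise recurse on p · g.
      p^[1+a]∣ : ∀ a {g x} → Annihilates (p ℕ.^ suc a) g → ¬ Annihilates (p ℕ.^ a) g →
        Annihilates x g → p ℕ.^ suc a ∣ x
      p^[1+a]∣ a {g} {x} p^[1+a]g≈ε p^ag≉ε xg≈ε with p ∣? x
      ... | no p∤x = contradiction (coprime-annihilators (prime∤⇒coprime p∤x) p·h≈ε x·h≈ε) p^ag≉ε
        where
        p·h≈ε : p · (p ℕ.^ a · g) ≈ ε
        p·h≈ε = trans (·-assocˡ g p (p ℕ.^ a)) p^[1+a]g≈ε
        x·h≈ε : x · (p ℕ.^ a · g) ≈ ε
        x·h≈ε = begin
          x · (p ℕ.^ a · g)     ≈⟨ ·-assocˡ g x (p ℕ.^ a) ⟩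
          (x ℕ.* p ℕ.^ a) · g   ≈⟨ ·-≡ g (ℕ.*-comm x (p ℕ.^ a)) ⟩
          (p ℕ.^ a ℕ.* x) · g   ≈⟨ ·-assocˡ g (p ℕ.^ a) x ⟨
          p ℕ.^ a · (x · g)     ≈⟨ ·-congʳ (p ℕ.^ a) xg≈ε ⟩
          p ℕ.^ a · ε           ≈⟨ ·-ε (p ℕ.^ a) ⟩
          ε                     ∎
      ... | yes (divides q x≡q*p) with a
      ...   | zero   = ≡.subst (_∣ x) (≡.sym (ℕ.*-identityʳ p)) (divides q x≡q*p)
      ...   | suc a′ = ≡.subst (_∣ x) (ℕ.*-comm (p ℕ.^ suc a′) p)
                         (≡.subst (p ℕ.^ suc a′ ℕ.* p ∣_) (≡.sym x≡q*p) (*-pres-∣ p^[1+a′]∣q ∣-refl))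
        where
        p^[1+a′]∣q : p ℕ.^ suc a′ ∣ q
        p^[1+a′]∣q = p^[1+a]∣ a′ {p · g} {q}
          (trans (p^n·p·g≈p^[1+n]·g (suc a′) g) p^[1+a]g≈ε)
          (p^ag≉ε ∘ trans (sym (p^n·p·g≈p^[1+n]·g a′ g)))
          (trans (·-assocˡ g q p) (trans (·-≡ g (≡.sym x≡q*p)) xg≈ε))

      ·-cancel-mod : ∀ a {g} → Annihilates (p ℕ.^ suc a) g → ¬ Annihilates (p ℕ.^ a) g →
        ∀ {x y} → x · g ≈ y · g →
        (x % p ℕ.^ suc a) {{ℕ.m^n≢0 p (suc a)}} ≡.≡ (y % p ℕ.^ suc a) {{ℕ.m^n≢0 p (suc a)}}
      ·-cancel-mod a {g} p^[1+a]g≈ε p^ag≉ε {x} {y} xg≈yg =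
        [ (λ y≤x → reduce y≤x xg≈yg) , (λ x≤y → ≡.sym (reduce x≤y (sym xg≈yg))) ]′ (ℕ.≤-total y x)
        where
        instance _ = ℕ.m^n≢0 p (suc a)
        reduce : ∀ {x y} → y ≤ x → x · g ≈ y · g → x % p ℕ.^ suc a ≡.≡ y % p ℕ.^ suc a
        reduce {x} {y} y≤x xg≈yg = ≡.trans (≡.cong (_% p ℕ.^ suc a) (≡.sym (ℕ.m+[n∸m]≡n y≤x)))
          (%-remove-+ʳ y (p^[1+a]∣ a p^[1+a]g≈ε p^ag≉ε [x∸y]g≈ε))
          where
          [x∸y]g≈ε : (x ∸ y) · g ≈ ε
          [x∸y]g≈ε = identityʳ-unique (y · g) _ (begin
            y · g ∙ (x ∸ y) · g   ≈⟨ ·-homo-+ g y (x ∸ y) ⟨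
            (y ℕ.+ (x ∸ y)) · g   ≈⟨ ·-≡ g (ℕ.m+[n∸m]≡n y≤x) ⟩
            x · g                 ≈⟨ xg≈yg ⟩
            y · g                 ∎)

    private
      ⊕ℤ/pᵃ : List ℕ → AbelianGroup c ℓ
      ⊕ℤ/pᵃ = ⊕ℤ/p^ p

    module Combination (Q : AbelianGroup c ℓ) where
      open AbelianGroup Q
      open Multiples Q
      open import Algebra.Properties.CommutativeSemigroup commutativeSemigroup using (interchange)
      open import Relation.Binary.Reasoning.Setoid setoid
      private module ⊕ as = AbelianGroup (⊕ℤ/pᵃ as)

      Generators : List ℕ → Set c
      Generators as = Vec Carrier (length as)

      OrdersDivide : ∀ as → Generators as → Set ℓ
      OrdersDivide []       []       = ⊤
      OrdersDivide (a ∷ as) (h ∷ hs) = Annihilates (p ℕ.^ a) h × OrdersDivide as hs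

      combine : ∀ as → Generators as → ⊕.Carrier as → Carrier
      combine []       []       _       = ε
      combine (a ∷ as) (h ∷ hs) (x , w) = lower x · h ∙ combine as hs w

      combine-congʳ : ∀ as hs → OrdersDivide as hs → ∀ {w w′} → ⊕._≈_ as w w′ → combine as hs w ≈ combine as hs w′
      combine-congʳ []       []       _                {_}     {_}       _ = refl
      combine-congʳ (a ∷ as) (h ∷ hs) (p^ah≈ε , orders) {x , w} {y , w′} (lift x≡y , w≈w′) = ∙-cong
        (begin
          lower x · h                               ≈⟨ ·-% {{ℕ.m^n≢0 p a}} p^ah≈ε (lower x) ⟩
          ((lower x % p ℕ.^ a) {{ℕ.m^n≢0 p a}}) · h ≈⟨ ·-≡ h x≡y ⟩
          ((lower y % p ℕ.^ a) {{ℕ.m^n≢0 p a}}) · h ≈⟨ ·-% {{ℕ.m^n≢0 p a}} p^ah≈ε (lower y) ⟨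
          lower y · h                               ∎)
        (combine-congʳ as hs orders w≈w′)

      combine-homo : ∀ as hs w w′ → combine as hs (⊕._∙_ as w w′) ≈ combine as hs w ∙ combine as hs w′
      combine-homo []       []       _       _         = sym (identityˡ ε)
      combine-homo (a ∷ as) (h ∷ hs) (x , w) (x′ , w′) = begin
        (lower x ℕ.+ lower x′) · h ∙ combine as hs (⊕._∙_ as w w′)
          ≈⟨ ∙-cong (·-homo-+ h (lower x) (lower x′)) (combine-homo as hs w w′) ⟩
        (lower x · h ∙ lower x′ · h) ∙ (combine as hs w ∙ combine as hs w′)
          ≈⟨ interchange (lower x · h) _ _ _ ⟩
        (lower x · h ∙ combine as hs w) ∙ (lower x′ · h ∙ combine as hs w′) ∎

      combine-congˡ : ∀ as {hs hs′} → Pointwise _≈_ hs hs′ → ∀ w → combine as hs w ≈ combine as hs′ w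
      combine-congˡ []       []              _       = refl
      combine-congˡ (a ∷ as) (h≈h′ ∷ hs≈hs′) (x , w) = ∙-cong (·-congʳ (lower x) h≈h′) (combine-congˡ as hs≈hs′ w)

    record Basis (Q : AbelianGroup c ℓ) (s : ℕ) : Set (c ⊔ ℓ) where
      open AbelianGroup Q
      open Combination Q
      field
        parts       : List ℕ
        partition   : PartitionBelow s parts
        generators  : Generators parts
        orders      : OrdersDivide parts generators
        independent : ∀ {w w′} → combine parts generators w ≈ combine parts generators w′ →
                      AbelianGroup._≈_ (⊕ℤ/pᵃ parts) w w′
        spanning    : ∀ x → Σ (AbelianGroup.Carrier (⊕ℤ/pᵃ parts)) λ w → combine parts generators w ≈ x

    module _ {Q : AbelianGroup c ℓ} where
      open AbelianGroup Q
      open Multiples Q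

      trivialBasis : ∀ {s} → (∀ x → x ≈ ε) → Basis Q s
      trivialBasis Q≈ε = record
        { parts = [] ; partition = [] ; generators = [] ; orders = _
        ; independent = _ ; spanning = λ x → _ , sym (Q≈ε x) }

      record ElementOfMaximalOrder (s : ℕ) : Set (c ⊔ ℓ) where
        field
          exponent    : ℕ
          element     : Carrier
          exponent<s  : exponent < s
          annihilates : AnnihilatedBy (p ℕ.^ suc exponent)
          exact       : ¬ Annihilates (p ℕ.^ exponent) element

      annihilated-resp : ∀ {n x y} → x ≈ y → Annihilates n x → Annihilates n y
      annihilated-resp {n} x≈y = trans (sym (·-congʳ n x≈y))

      trivial⊎maximal : ∀ {N} → Enumeration Q N → ∀ s → AnnihilatedBy (p ℕ.^ s) →
        (∀ x → x ≈ ε) ⊎ ElementOfMaximalOrder s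
      trivial⊎maximal E zero    p⁰Q≈ε = inj₁ λ x → trans (sym (·-homo-1 x)) (p⁰Q≈ε x)
      trivial⊎maximal E (suc s) pˢ⁺¹Q≈ε with all? (annihilated-resp {p ℕ.^ s}) (λ x → (p ℕ.^ s · x) ≟ ε)
        where open Enumeration E
      ... | yes pˢQ≈ε = Data.Sum.map₂ weaken (trivial⊎maximal E s pˢQ≈ε)
        where
        weaken : ElementOfMaximalOrder s → ElementOfMaximalOrder (suc s)
        weaken m = record { ElementOfMaximalOrder m ; exponent<s = ℕ.m<n⇒m<1+n (ElementOfMaximalOrder.exponent<s m) }
      ... | no ¬pˢQ≈ε = inj₂ record
        { exponent = s ; element = proj₁ g ; exponent<s = ℕ.≤-refl ; annihilates = pˢ⁺¹Q≈ε ; exact = proj₂ g }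
        where
        open Enumeration E
        g = ¬∀⇒∃¬ (annihilated-resp {p ℕ.^ s}) (λ x → (p ℕ.^ s · x) ≟ ε) ¬pˢQ≈ε

    module Extend {Q : AbelianGroup c ℓ} {s} (m : ElementOfMaximalOrder {Q = Q} s) where
      open AbelianGroup Q
      open Multiples Q
      open ElementOfMaximalOrder m renaming (exponent to a; element to g; annihilates to p^[1+a]Q≈ε; exact to p^ag≉ε)

      open CyclicQuotient Q g (p ℕ.^ suc a) {{ℕ.m^n≢0 p (suc a)}} (p^[1+a]Q≈ε g)
      open Order Q using (p^[1+a]∣; ·-cancel-mod)
      open import Algebra.Properties.Group group using (∙-cancelʳ)
      open import Relation.Binary.Reasoning.Setoid setoid
      private
        module Q/g = AbelianGroup quotient
        module C   = Combination Q
        module C/g = Combination quotient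

      combine-quotient : ∀ as hs w → C/g.combine as hs w ≡.≡ C.combine as hs w
      combine-quotient []       []       _       = ≡.refl
      combine-quotient (a ∷ as) (h ∷ hs) (x , w) = ≡.cong₂ _∙_ (·⟨g⟩≡· (lower x) h) (combine-quotient as hs w)

      multiple∙≈⟨g⟩ : ∀ n y → n · g ∙ y ≈⟨g⟩ y
      multiple∙≈⟨g⟩ n y = n , comm (n · g) y

      -- The key step: a coset of ⟨g⟩ of order p^b contains an element of order p^b, since g has maximal order.
      lift-generator : ∀ {b} → b ≤ suc a → ∀ h′ → Q/g._≈_ (Multiples._·_ quotient (p ℕ.^ b) h′) ε →
        Σ Carrier λ h → p ℕ.^ b · h ≈ ε × h ≈⟨g⟩ h′
      lift-generator {b} b≤1+a h′ (k , p^b·′h′≈ε∙k·g) = h′ ∙ (d · g) ⁻¹ , p^b·h≈ε , sym⟨g⟩ (d , h′≈h∙d·g)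
        where
        e = suc a ∸ b
        p^e*p^b≡p^[1+a] : p ℕ.^ e ℕ.* p ℕ.^ b ≡.≡ p ℕ.^ suc a
        p^e*p^b≡p^[1+a] = ≡.trans (≡.sym (ℕ.^-distribˡ-+-* p e b)) (≡.cong (p ℕ.^_) (ℕ.m∸n+n≡m b≤1+a))
        p^b·h′≈k·g : p ℕ.^ b · h′ ≈ k · g
        p^b·h′≈k·g = trans (reflexive (≡.sym (·⟨g⟩≡· (p ℕ.^ b) h′)))
                           (trans p^b·′h′≈ε∙k·g (identityˡ (k · g)))
        [p^e*k]·g≈ε : (p ℕ.^ e ℕ.* k) · g ≈ ε
        [p^e*k]·g≈ε = begin
          (p ℕ.^ e ℕ.* k) · g         ≈⟨ ·-assocˡ g (p ℕ.^ e) k ⟨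
          p ℕ.^ e · k · g             ≈⟨ ·-congʳ (p ℕ.^ e) p^b·h′≈k·g ⟨
          p ℕ.^ e · p ℕ.^ b · h′      ≈⟨ ·-assocˡ h′ (p ℕ.^ e) (p ℕ.^ b) ⟩
          (p ℕ.^ e ℕ.* p ℕ.^ b) · h′  ≈⟨ ·-≡ h′ p^e*p^b≡p^[1+a] ⟩
          p ℕ.^ suc a · h′            ≈⟨ p^[1+a]Q≈ε h′ ⟩
          ε                           ∎
        p^b∣k : p ℕ.^ b ∣ k
        p^b∣k = *-cancelˡ-∣ (p ℕ.^ e) {{ℕ.m^n≢0 p e}}
          (≡.subst (_∣ p ℕ.^ e ℕ.* k) (≡.sym p^e*p^b≡p^[1+a]) (p^[1+a]∣ a (p^[1+a]Q≈ε g) p^ag≉ε [p^e*k]·g≈ε))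
        d = _∣_.quotient p^b∣k
        p^b*d≡k : p ℕ.^ b ℕ.* d ≡.≡ k
        p^b*d≡k = ≡.trans (ℕ.*-comm (p ℕ.^ b) d) (≡.sym (_∣_.equality p^b∣k))
        p^b·h≈ε : p ℕ.^ b · (h′ ∙ (d · g) ⁻¹) ≈ ε
        p^b·h≈ε = begin
          p ℕ.^ b · (h′ ∙ (d · g) ⁻¹)            ≈⟨ ·-distrib-∙ h′ _ (p ℕ.^ b) ⟩
          p ℕ.^ b · h′ ∙ p ℕ.^ b · (d · g) ⁻¹    ≈⟨ ∙-cong p^b·h′≈k·g (·-⁻¹ (p ℕ.^ b) (d · g)) ⟩
          k · g ∙ (p ℕ.^ b · d · g) ⁻¹           ≈⟨ ∙-congˡ (⁻¹-cong (·-assocˡ g (p ℕ.^ b) d)) ⟩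
          k · g ∙ ((p ℕ.^ b ℕ.* d) · g) ⁻¹       ≈⟨ ∙-congˡ (⁻¹-cong (·-≡ g p^b*d≡k)) ⟩
          k · g ∙ (k · g) ⁻¹                     ≈⟨ inverseʳ (k · g) ⟩
          ε                                      ∎
        h′≈h∙d·g : h′ ≈ h′ ∙ (d · g) ⁻¹ ∙ d · g
        h′≈h∙d·g = sym (trans (assoc h′ _ _) (trans (∙-congˡ (inverseˡ (d · g))) (identityʳ h′)))

      lift-generators : ∀ {t bs} → t ≤ suc a → PartitionBelow t bs → ∀ hs′ → C/g.OrdersDivide bs hs′ →
        Σ (C.Generators bs) λ hs → C.OrdersDivide bs hs × Pointwise _≈⟨g⟩_ hs hs′
      lift-generators t≤1+a []                        []          _                = [] , _ , []
      lift-generators t≤1+a (part _ b≤t partition) (h′ ∷ hs′) (h′-order , orders′) =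
        let b≤1+a                 = ℕ.≤-trans b≤t t≤1+a
            (h  , h-order , h≈h′) = lift-generator b≤1+a h′ h′-order
            (hs , orders , hs≈hs′) = lift-generators b≤1+a partition hs′ orders′
        in h ∷ hs , (h-order , orders) , h≈h′ ∷ hs≈hs′

      module _ (B : Basis quotient (suc a)) where
        private module B = Basis B

        lifted = lift-generators ℕ.≤-refl B.partition B.generators B.orders
        hs     = proj₁ lifted

        combine≈⟨g⟩ : ∀ w → C.combine B.parts hs w ≈⟨g⟩ C/g.combine B.parts B.generators w
        combine≈⟨g⟩ w = ≡.subst (_≈⟨g⟩ C/g.combine B.parts B.generators w) (combine-quotient B.parts hs w)
          (C/g.combine-congˡ B.parts (proj₂ (proj₂ lifted)) w)

        independent : ∀ {v v′} → C.combine (suc a ∷ B.parts) (g ∷ hs) v ≈ C.combine (suc a ∷ B.parts) (g ∷ hs) v′ →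
          AbelianGroup._≈_ (⊕ℤ/pᵃ (suc a ∷ B.parts)) v v′
        independent {lift x , w} {lift x′ , w′} x·g∙Cw≈x′·g∙Cw′ =
          lift (·-cancel-mod a (p^[1+a]Q≈ε g) p^ag≉ε x·g≈x′·g) , w≈w′
          where
          Cw≈⟨g⟩Cw′ : C.combine B.parts hs w ≈⟨g⟩ C.combine B.parts hs w′
          Cw≈⟨g⟩Cw′ = trans⟨g⟩ (sym⟨g⟩ (multiple∙≈⟨g⟩ x _))
                        (trans⟨g⟩ (≈⇒≈⟨g⟩ x·g∙Cw≈x′·g∙Cw′) (multiple∙≈⟨g⟩ x′ _))
          w≈w′ : AbelianGroup._≈_ (⊕ℤ/pᵃ B.parts) w w′
          w≈w′ = B.independent (trans⟨g⟩ (sym⟨g⟩ (combine≈⟨g⟩ w)) (trans⟨g⟩ Cw≈⟨g⟩Cw′ (combine≈⟨g⟩ w′)))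
          x·g≈x′·g : x · g ≈ x′ · g
          x·g≈x′·g = ∙-cancelʳ (C.combine B.parts hs w) _ _
            (trans x·g∙Cw≈x′·g∙Cw′ (∙-congˡ (sym (C.combine-congʳ B.parts hs (proj₁ (proj₂ lifted)) w≈w′))))

        spanning : ∀ y → Σ (AbelianGroup.Carrier (⊕ℤ/pᵃ (suc a ∷ B.parts))) λ v →
          C.combine (suc a ∷ B.parts) (g ∷ hs) v ≈ y
        spanning y =
          let (w , Cw≈⟨g⟩y) = B.spanning y
              (k , y≈Cw∙k·g) = sym⟨g⟩ (trans⟨g⟩ (combine≈⟨g⟩ w) Cw≈⟨g⟩y)
          in (lift k , w) , trans (comm (k · g) _) (sym y≈Cw∙k·g)

      extend : Basis quotient (suc a) → Basis Q s
      extend B = record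
        { parts       = suc a ∷ Basis.parts B
        ; partition   = part (s≤s z≤n) exponent<s (Basis.partition B)
        ; generators  = g ∷ hs B
        ; orders      = p^[1+a]Q≈ε g , proj₁ (proj₂ (lifted B))
        ; independent = independent B
        ; spanning    = spanning B
        }

    decompose : ∀ {Q : AbelianGroup c ℓ} {N} (E : Enumeration Q N) → Acc _⊃_ (Enumeration.zeros E) →
      ∀ s → Multiples.AnnihilatedBy Q (p ℕ.^ s) → Basis Q s
    decompose {Q} E (acc rec) s pˢQ≈ε with trivial⊎maximal E s pˢQ≈ε
    ... | inj₁ Q≈ε = trivialBasis Q≈ε
    ... | inj₂ m   = Extend.extend m (decompose E/g (rec (zeros⊂ g≉ε)) (suc a) p^[1+a]Q/g≈ε)
      where
      open AbelianGroup Q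
      open Multiples Q
      open ElementOfMaximalOrder m renaming (exponent to a; element to g)
      open QuotientEnumeration E g (p ℕ.^ suc a) {{ℕ.m^n≢0 p (suc a)}} (annihilates g)
      open CyclicQuotient Q g (p ℕ.^ suc a) {{ℕ.m^n≢0 p (suc a)}} (annihilates g)
      E/g = quotientEnumeration
      g≉ε : ¬ g ≈ ε
      g≉ε g≈ε = exact (trans (·-congʳ (p ℕ.^ a) g≈ε) (·-ε (p ℕ.^ a)))
      p^[1+a]Q/g≈ε : Multiples.AnnihilatedBy quotient (p ℕ.^ suc a)
      p^[1+a]Q/g≈ε x = ≡.subst (_≈⟨g⟩ ε) (≡.sym (·⟨g⟩≡· (p ℕ.^ suc a) x)) (≈⇒≈⟨g⟩ (annihilates x))

    p^-cancel-≤ : ∀ {a b} → p ℕ.^ a ≤ p ℕ.^ b → a ≤ b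
    p^-cancel-≤ p^a≤p^b = ℕ.≮⇒≥ λ b<a → ℕ.<⇒≱ (ℕ.^-monoʳ-< p 1<p b<a) p^a≤p^b
      where 1<p = ℕ.nonTrivial⇒n>1 p {{prime⇒nonTrivial p-prime}}

    p-group-structure : ∀ {H : AbelianGroup c ℓ} {k} → HasOrder H (p ℕ.^ k) →
      Σ (List ℕ) λ as → PartitionBelow k as × sum as ≤ k × EmbedsInto H (⊕ℤ/pᵃ as)
    p-group-structure {H} {k} ∣H∣≡pᵏ = parts , partition , sum≤k
      , bijection⇒EmbedsInto {A = ⊕ℤ/pᵃ parts} {B = H} (combine parts generators)
          (combine-congʳ parts generators orders) (combine-homo parts generators) independent spanning
      where
      E = enumeration {H = H} ∣H∣≡pᵏ
      open Basis (decompose E (⊃-wellFounded (Enumeration.zeros E)) k (lagrange {H = H} ∣H∣≡pᵏ))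
      open Combination H
      sum≤k : sum parts ≤ k
      sum≤k = p^-cancel-≤ (HasOrder-≤ {A = ⊕ℤ/pᵃ parts} {B = H} (HasOrder-⊕ℤ/p^ p parts) ∣H∣≡pᵏ
                                      (combine parts generators) independent)

open ExponentialBound using (floorQuotients; sum-floorQuotients≤)
open GroupConstructions using (⊕ℤ/p^; HasOrder-⊕ℤ/p^; ⊕ℤ/p^-EmbedsInto; EmbedsInto-trans)
open Partitions using (partition-fits)
open PGroupStructure using (p-group-structure)

lemma2p5 : ∀ {c ℓ : Level} (n p : ℕ) → Prime p → (m : ℕ) → IsFloorNLog n m →
    Σ (AbelianGroup c ℓ) λ G → HasOrder G (p ^ m) ×
      ((H : AbelianGroup c ℓ) (k : ℕ) → k ≤ n → HasOrder H (p ^ k) → EmbedsInto H G)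
lemma2p5 {c} {ℓ} n p p-prime m m≡⌊n+nlogn⌋ = G , ∣G∣≡pᵐ , embed
  where
  instance _ = prime⇒nonZero p-prime
  padding = m ∸ sum (floorQuotients n)
  exponents : List ℕ
  exponents = floorQuotients n ++ padding ∷ []
  G : AbelianGroup c ℓ
  G = ⊕ℤ/p^ p exponents
  ∣G∣≡pᵐ : HasOrder G (p ^ m)
  ∣G∣≡pᵐ = ≡.subst (HasOrder G ∘ (p ^_)) sum-exponents≡m (HasOrder-⊕ℤ/p^ p exponents)
    where
    open ≡.≡-Reasoning
    sum-exponents≡m : sum exponents ≡.≡ m
    sum-exponents≡m = begin
      sum exponents                            ≡⟨ sum-++ (floorQuotients n) (padding ∷ []) ⟩
      sum (floorQuotients n) + (padding + 0)   ≡⟨ ≡.cong (sum (floorQuotients n) +_) (ℕ.+-identityʳ padding) ⟩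
      sum (floorQuotients n) + padding         ≡⟨ ℕ.m+[n∸m]≡n (sum-floorQuotients≤ m≡⌊n+nlogn⌋) ⟩
      m                                        ∎
  embed : (H : AbelianGroup c ℓ) (k : ℕ) → k ≤ n → HasOrder H (p ^ k) → EmbedsInto H G
  embed H k k≤n ∣H∣≡pᵏ =
    let (as , partition , sum≤k , H↪⊕ℤ/pᵃˢ) = p-group-structure p-prime {H = H} {k = k} ∣H∣≡pᵏ
    in EmbedsInto-trans {A = H} {B = ⊕ℤ/p^ p as} {C = G} H↪⊕ℤ/pᵃˢ (⊕ℤ/p^-EmbedsInto p
         (partition-fits (λ i → n / suc i) 0 n partition (ℕ.≤-trans sum≤k k≤n) ℕ.≤-refl λ _ → ℕ.≤-refl))
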